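{- For every $j=1,\dots,\ell-1$, the restriction of $\dot f_j^{\,*}$ to any connected component of the type $A_{n-1}$ crystal $F(s)$ is either $0$ or an isomorphism of $A_{n-1}$-crystals (onto its image). Similarly, for every $i=1,\dots,n-1$, the restriction of ${}^*f_i$ to any connected component of the type $A_{\ell-1}$ crystal $\dot F(s)$ is either $0$ or an isomorphism of $A_{\ell-1}$-crystals.
   Context: Fix integers $n,\ell\ge2$, $s\ge0$. $F(s)$: set of $b=c_\ell\otimes\cdots\otimes c_1$ with $c_j\subseteq\{1,\dots,n\}$, $\sum|c_j|=s$; $\dot F(s)$: set of $d_1\otimes\cdots\otimes d_n$ with $d_i\subseteq\{1,\dots,\ell\}$, $\sum|d_i|=s$. Duality: $b^*=d(1)\otimes\cdots\otimes d(n)$, $d(i)=\{j:i\in c_j\}$ (bijection $F(s)\to\dot F(s)$). For $\varphi$ on $\dot F(s)$, $\varphi^*(b)=(\varphi(b^*))^*$ (or $0$ if $\varphi(b^*)=0$); for $\psi$ on $F(s)$, ${}^*\psi(b^*)=(\psi(b))^*$ (or $0$ if $\psi(b)=0$). Crystal operators: the word of $c_\ell\otimes\cdots\otimes c_1$ concatenates the entries of $c_\ell$ (increasing), then $c_{\ell-1}$, ..., $c_1$; the word of $d_1\otimes\cdots\otimes d_n$ concatenates $d_1,\dots,d_n$. For a letter pair $(k,k+1)$, keep letters $k,k+1$ of the word, encode $k$ by $+$ and $k+1$ by $-$, delete adjacent $+-$ recursively; the lowering operator changes the $k$ of the leftmost remaining $+$ into $k+1$ (or gives $0$), the raising operator changes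 the $k+1$ of the rightmost remaining $-$ into $k$ (or gives $0$). With $k=i\in\{1,\dots,n-1\}$ on $F(s)$ this gives $f_i,e_i$ (type $A_{n-1}$); with $k=j\in\{1,\dots,\ell-1\}$ on $\dot F(s)$ this gives $\dot f_j,\dot e_j$ (type $A_{\ell-1}$). -}

module Defs where

open import Data.Bool using (Bool; true; false; if_then_else_)
open import Data.Nat using (ℕ; suc)
open import Data.Fin using (Fin; inject₁) renaming (suc to fsuc)
open import Data.Fin.Subset using (Subset; ∣_∣)
open import Data.Vec as Vec using (Vec; lookup; _[_]≔_; transpose; tabulate)
open import Data.List as List using (List; []; _∷_; _++_; [_]; concatMap; foldl; reverse; allFin)
open import Data.Maybe using (Maybe; just; nothing; Is-just; _>>=_)
open import Data.Product using (_×_; _,_)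
open import Data.Sum using (_⊎_)
open import Relation.Binary.PropositionalEquality using (_≡_)

-- A tensor product x_p ⊗ ... ⊗ x_1 (or x_1 ⊗ ... ⊗ x_p) of subsets
-- of an alphabet {1,...,m+1} is a vector X : Vec (Subset (suc m)) p, where
-- position t : Fin p holds the factor x_{t+1}, and letter k : Fin (suc m)
-- stands for the letter k+1.  The operator index i : Fin m stands for i+1,
-- the letter pair (i+1, i+2) being (inject₁ i , fsuc i).
--
-- F(s)  : b = c_ℓ ⊗ ... ⊗ c_1   is  Vec (Subset n) ℓ   (position t = c_{t+1})
-- Ḟ(s)  : d_1 ⊗ ... ⊗ d_n        is  Vec (Subset ℓ) n   (position t = d_{t+1})

Tensor : ℕ → ℕ → Set
Tensor m p = Vec (Subset m) p

size : ∀ {m p} → Tensor m p → ℕ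
size X = Vec.sum (Vec.map ∣_∣ X)

wt : ∀ {m p} → Tensor m p → Vec ℕ m
wt X = Vec.map ∣_∣ (transpose X)

-- signs contributed by one factor (its entries read increasingly):
-- true = '+' (letter i), false = '-' (letter i+1), tagged with the factor
signsAt : ∀ {m p} → Fin m → Tensor (suc m) p → Fin p → List (Bool × Fin p)
signsAt i X t =
  (if lookup (lookup X t) (inject₁ i) then [ (true , t) ] else [])
  ++ (if lookup (lookup X t) (fsuc i) then [ (false , t) ] else [])

signWord : ∀ {m p} → List (Fin p) → Fin m → Tensor (suc m) p → List (Bool × Fin p)
signWord order i X = concatMap (signsAt i X) order

-- cancellation of adjacent "+-" pairs, done left to right with a stack
-- (the stack holds the reduced word so far, in reverse order)
push : ∀ {A : Set} → List (Bool × A) → Bool × A → List (Bool × A)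
push ((true , a) ∷ st) (false , b) = st
push st x = x ∷ st

reducedRev : ∀ {m p} → List (Fin p) → Fin m → Tensor (suc m) p → List (Bool × Fin p)
reducedRev order i X = foldl push [] (signWord order i X)

firstWith : ∀ {A : Set} → Bool → List (Bool × A) → Maybe A
firstWith b [] = nothing
firstWith true ((true , a) ∷ w) = just a
firstWith false ((false , a) ∷ w) = just a
firstWith true ((false , a) ∷ w) = firstWith true w
firstWith false ((true , a) ∷ w) = firstWith false w

-- factor holding the leftmost remaining '+', resp. rightmost remaining '-'
lowerPos raisePos : ∀ {m p} → List (Fin p) → Fin m → Tensor (suc m) p → Maybe (Fin p)
lowerPos order i X = firstWith true (reverse (reducedRev order i X))
raisePos order i X = firstWith false (reducedRev order i X)

-- lowering / raising operators (nothing = 0)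
fOp eOp : ∀ {m p} → List (Fin p) → Fin m → Tensor (suc m) p → Maybe (Tensor (suc m) p)
fOp order i X = Data.Maybe.map
  (λ t → X [ t ]≔ ((lookup X t [ inject₁ i ]≔ false) [ fsuc i ]≔ true))
  (lowerPos order i X)
eOp order i X = Data.Maybe.map
  (λ t → X [ t ]≔ ((lookup X t [ fsuc i ]≔ false) [ inject₁ i ]≔ true))
  (raisePos order i X)

-- Type A_{n-1} crystal F(s): word of c_ℓ ⊗ ... ⊗ c_1 reads c_ℓ first
fF eF : ∀ {n' ℓ} → Fin n' → Tensor (suc n') ℓ → Maybe (Tensor (suc n') ℓ)
fF {ℓ = ℓ} = fOp (reverse (allFin ℓ))
eF {ℓ = ℓ} = eOp (reverse (allFin ℓ))

-- Type A_{ℓ-1} crystal Ḟ(s): word of d_1 ⊗ ... ⊗ d_n reads d_1 first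
fḞ eḞ : ∀ {ℓ' n} → Fin ℓ' → Tensor (suc ℓ') n → Maybe (Tensor (suc ℓ') n)
fḞ {n = n} = fOp (allFin n)
eḞ {n = n} = eOp (allFin n)

-- duality b ↦ b* : d(i) = { j : i ∈ c_j }  is transposition of the 0/1 matrix
dual : ∀ {m p} → Tensor m p → Tensor p m
dual = transpose

-- φ^* (b) = (φ(b*))*  ;  *ψ (b*) = (ψ(b))*   (same formula, on the other side)
star : ∀ {m p} → (Tensor p m → Maybe (Tensor p m)) → Tensor m p → Maybe (Tensor m p)
star φ b = Data.Maybe.map dual (φ (dual b))

-- connected components: reachability via the f_i and e_i
data Reach {X I : Set} (f e : I → X → Maybe X) (b₀ : X) : X → Set where
  here : Reach f e b₀ b₀
  viaF : ∀ {b b'} (i : I) → Reach f e b₀ b → f i b ≡ just b' → Reach f e b₀ b'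
  viaE : ∀ {b b'} (i : I) → Reach f e b₀ b → e i b ≡ just b' → Reach f e b₀ b'

-- ψ restricted to the connected component of b₀ (for the crystal (f,e,wt))
-- is either 0, or an isomorphism of crystals onto its image: defined
-- everywhere on the component, injective there, weight preserving, and
-- commuting with all f_i and e_i (with 0 absorbing).
ZeroOrIso : ∀ {X I W : Set} (f e : I → X → Maybe X) (w : X → W)
            (ψ : X → Maybe X) (b₀ : X) → Set
ZeroOrIso {X} {I} f e w ψ b₀ =
  (∀ b → Reach f e b₀ b → ψ b ≡ nothing)
  ⊎ ((∀ b → Reach f e b₀ b → Is-just (ψ b))
     × (∀ b b' → Reach f e b₀ b → Reach f e b₀ b' → ψ b ≡ ψ b' → b ≡ b')
     × (∀ b b' → Reach f e b₀ b → ψ b ≡ just b' → w b' ≡ w b)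
     × (∀ (i : I) b → Reach f e b₀ b → (f i b >>= ψ) ≡ (ψ b >>= f i))
     × (∀ (i : I) b → Reach f e b₀ b → (e i b >>= ψ) ≡ (ψ b >>= e i)))

-- Write b as a 0/1 matrix whose rows are the factors of F(s) and whose columns are the
-- factors of Ḟ(s). The signature rule of f_i reads two adjacent columns row by row, that of
-- ḟ_j^* reads two adjacent rows column by column, and each operator moves one entry inside
-- its pair. A move outside the 2×2 block where the two pairs meet leaves the reduced word of
-- the other operator unchanged, while a move inside the block merely exchanges the two
-- positions of the block in it; checking the block by hand then shows that f_i and e_i
-- commute with ḟ_j^*. Since f_i and e_i are mutually inverse and ḟ_j^* is injective and
-- weight preserving where defined, ḟ_j^* is 0 or an isomorphism on each component. The
-- second statement follows by transposing the matrix.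
module Submission where

open import Defs
open import Data.Bool using (Bool; true; false; if_then_else_)
open import Data.Empty using (⊥-elim)
open import Data.Fin using (Fin; inject₁) renaming (zero to fzero; suc to fsuc)
open import Data.Fin.Properties using (suc-injective; _≟_)
import Data.Fin.Permutation.Components as PC
open import Data.Fin.Subset using (Subset; ∣_∣)
open import Data.List as List
  using (List; []; _∷_; _++_; [_]; _∷ʳ_; foldl; reverse; map; drop; take; length; head; last; allFin; concatMap)
open import Data.List.Properties
  using (reverse-++; reverse-map; unfold-reverse; last-map; head-map; ++-assoc; map-++; map-tabulate; map-cong;
         concatMap-++; foldl-++)
open import Data.List.Membership.Propositional using (_∈_)
import Data.List.Relation.Binary.Sublist.Propositional as Sublist
open import Data.List.Relation.Binary.Sublist.Propositional.Properties using (drop-⊆; take-⊆)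
open import Data.List.Relation.Unary.All as All using (All; []; _∷_)
open import Data.List.Relation.Unary.All.Properties using (∷ʳ⁺; map⁺; ++⁺)
open import Data.List.Relation.Unary.Any using (here; there)
open import Data.Maybe as Maybe using (Maybe; just; nothing; _<∣>_; _>>=_; Is-just)
open import Data.Maybe.Properties using (just-injective; map-∘)
open import Data.Maybe.Relation.Unary.Any using (just)
open import Data.Nat using (ℕ; suc; zero; _∸_; _≤_)
open import Data.Nat.Properties using (0∸n≡0)
open import Data.Product using (_×_; _,_; proj₁; proj₂; map₂; swap; ∃)
open import Data.Sum using (_⊎_; inj₁; inj₂; [_,_]′)
open import Data.Unit using (tt)
open import Data.Vec as Vec using (Vec; lookup; _[_]≔_; transpose; _⊛_)
open import Data.Vec.Properties
  using (tabulate∘lookup; tabulate-cong; lookup-replicate; lookup-⊛; lookup-map; lookup∘update; lookup∘update′)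
open import Function using (id; _∘_)
open import Relation.Nullary using (¬_; yes; no)
open import Relation.Binary.PropositionalEquality
  using (_≡_; _≢_; refl; sym; trans; cong; cong₂; subst; subst₂; module ≡-Reasoning)

module _ {T : Set} where

  head-∷ʳ : ∀ (xs : List T) x → head (xs ∷ʳ x) ≡ head xs <∣> just x
  head-∷ʳ []       x = refl
  head-∷ʳ (_ ∷ _)  x = refl

  last-∷ : ∀ x (xs : List T) → last (x ∷ xs) ≡ last xs <∣> just x
  last-∷ x []           = refl
  last-∷ x (_ ∷ [])     = refl
  last-∷ x (_ ∷ y ∷ ys) = last-∷ x (y ∷ ys)

  head-reverse : ∀ (xs : List T) → head (reverse xs) ≡ last xs
  head-reverse []       = refl
  head-reverse (x ∷ xs) = begin
    head (reverse (x ∷ xs))     ≡⟨ cong head (unfold-reverse x xs) ⟩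
    head (reverse xs ∷ʳ x)      ≡⟨ head-∷ʳ (reverse xs) x ⟩
    head (reverse xs) <∣> just x ≡⟨ cong (_<∣> just x) (head-reverse xs) ⟩
    last xs <∣> just x          ≡⟨ sym (last-∷ x xs) ⟩
    last (x ∷ xs)               ∎
    where open ≡-Reasoning

  last-∈ : ∀ {xs : List T} {x} → last xs ≡ just x → x ∈ xs
  last-∈ {_ ∷ []}    refl = here refl
  last-∈ {_ ∷ _ ∷ _} e    = there (last-∈ e)

  head-∈ : ∀ {xs : List T} {x} → head xs ≡ just x → x ∈ xs
  head-∈ {_ ∷ _} refl = here refl

  last-++ : ∀ (xs ys : List T) {x} → last (xs ++ ys) ≡ just x → x ∈ xs ⊎ last ys ≡ just x
  last-++ []                 ys       e    = inj₂ e
  last-++ (z ∷ [])           []       refl = inj₁ (here refl)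
  last-++ (z ∷ [])           (_ ∷ _)  e    = inj₂ e
  last-++ (z ∷ xs@(_ ∷ _))   ys       e with last-++ xs ys e
  ... | inj₁ x∈xs = inj₁ (there x∈xs)
  ... | inj₂ e′   = inj₂ e′

  last-∷ʳ : ∀ (xs : List T) x → last (xs ∷ʳ x) ≡ just x
  last-∷ʳ []           x = refl
  last-∷ʳ (_ ∷ [])     x = refl
  last-∷ʳ (_ ∷ _ ∷ xs) x = last-∷ʳ (_ ∷ xs) x

  head-++ : ∀ (xs ys : List T) {x} → head (xs ++ ys) ≡ just x → x ∈ xs ⊎ head ys ≡ just x
  head-++ []      ys e    = inj₂ e
  head-++ (_ ∷ _) ys refl = inj₁ (here refl)

-- A word of signs reduces (by cancelling adjacent "+-") to "-…-+…+"; we keep its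
-- unmatched '+'s and its unmatched '-'s, each with the most recent one first.
-- The stack built by `push` is `encode` of this pair.
Reduced : Set → Set
Reduced T = List T × List T

module _ {T : Set} where

  ∅ : Reduced T
  ∅ = [] , []

  step : Reduced T → Bool × T → Reduced T
  step (ps , ms)     (true  , t) = t ∷ ps , ms
  step ([] , ms)     (false , t) = [] , t ∷ ms
  step (_ ∷ ps , ms) (false , t) = ps , ms

  reduce : Reduced T → List (Bool × T) → Reduced T
  reduce = foldl step

  encode : Reduced T → List (Bool × T)
  encode (ps , ms) = map (true ,_) ps ++ map (false ,_) ms

  push-encode : ∀ r x → push (encode r) x ≡ encode (step r x)
  push-encode ([] , [])     (true , t)  = refl
  push-encode ([] , _ ∷ _)  (true , t)  = refl
  push-encode (_ ∷ _ , ms)  (true , t)  = refl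
  push-encode ([] , [])     (false , t) = refl
  push-encode ([] , _ ∷ _)  (false , t) = refl
  push-encode (_ ∷ _ , ms)  (false , t) = refl

  foldl-push-encode : ∀ r w → foldl push (encode r) w ≡ encode (reduce r w)
  foldl-push-encode r []      = refl
  foldl-push-encode r (x ∷ w) rewrite push-encode r x = foldl-push-encode (step r x) w

  firstWith-true-reverse-encode : ∀ r → firstWith true (reverse (encode r)) ≡ last (proj₁ r)
  firstWith-true-reverse-encode (ps , ms) = begin
    firstWith true (reverse (map (true ,_) ps ++ map (false ,_) ms))
      ≡⟨ cong (firstWith true) (reverse-++ (map (true ,_) ps) (map (false ,_) ms)) ⟩
    firstWith true (reverse (map (false ,_) ms) ++ reverse (map (true ,_) ps))
      ≡⟨ skip-minuses (reverse ms) (cong₂ _++_ (sym (reverse-map _ ms)) (sym (reverse-map _ ps))) ⟩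
    firstWith true (map (true ,_) (reverse ps))
      ≡⟨ first-plus (reverse ps) ⟩
    head (reverse ps)
      ≡⟨ head-reverse ps ⟩
    last ps ∎
    where
    open ≡-Reasoning
    skip-minuses : ∀ ns {w} → w ≡ map (false ,_) ns ++ map (true ,_) (reverse ps) →
                   firstWith true w ≡ firstWith true (map (true ,_) (reverse ps))
    skip-minuses []       refl = refl
    skip-minuses (_ ∷ ns) refl = skip-minuses ns refl
    first-plus : ∀ qs → firstWith true (map (true ,_) qs) ≡ head qs
    first-plus []      = refl
    first-plus (_ ∷ _) = refl

  firstWith-false-encode : ∀ r → firstWith false (encode r) ≡ head (proj₂ r)
  firstWith-false-encode (ps , ms) = skip-pluses ps ms
    where
    skip-pluses : ∀ qs ns → firstWith false (map (true ,_) qs ++ map (false ,_) ns) ≡ head ns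
    skip-pluses (_ ∷ qs) ns      = skip-pluses qs ns
    skip-pluses []       []      = refl
    skip-pluses []       (_ ∷ _) = refl

  -- The reduced state of w₁ ++ w₂ from those of w₁ and of w₂: the unmatched '-'s
  -- of w₂ cancel the latest unmatched '+'s of w₁.
  cancel : Reduced T → Reduced T → Reduced T
  cancel (ps , ms) (qs , ns) = qs ++ drop (length ns) ps , take (length ns ∸ length ps) ns ++ ms

  private
    take-[] : ∀ k → take {A = T} k [] ≡ []
    take-[] zero    = refl
    take-[] (suc k) = refl

    step-minus-cancel : ∀ k ps ns ms (t : T) →
      step (drop k ps , take (k ∸ length ps) ns ++ ms) (false , t)
        ≡ (drop (suc k) ps , take (suc k ∸ length ps) (t ∷ ns) ++ ms)
    step-minus-cancel zero    []       ns ms t = refl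
    step-minus-cancel (suc k) []       ns ms t = refl
    step-minus-cancel zero    (_ ∷ ps) ns ms t rewrite 0∸n≡0 (length ps) = refl
    step-minus-cancel (suc k) (_ ∷ ps) ns ms t = step-minus-cancel k ps ns ms t

    step-cancel : ∀ r r′ x → step (cancel r r′) x ≡ cancel r (step r′ x)
    step-cancel (ps , ms) (qs , ns)     (true , t)  = refl
    step-cancel (ps , ms) (_ ∷ qs , ns) (false , t) = refl
    step-cancel (ps , ms) ([] , ns)     (false , t) = step-minus-cancel (length ns) ps ns ms t

    reduce-cancel′ : ∀ r r′ w → reduce (cancel r r′) w ≡ cancel r (reduce r′ w)
    reduce-cancel′ r r′ []      = refl
    reduce-cancel′ r r′ (x ∷ w) rewrite step-cancel r r′ x = reduce-cancel′ r (step r′ x) w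

  cancel-∅ : ∀ r → cancel r ∅ ≡ r
  cancel-∅ (ps , ms) rewrite take-[] (0 ∸ length ps) = refl

  reduce-cancel : ∀ r w → reduce r w ≡ cancel r (reduce ∅ w)
  reduce-cancel r w = trans (cong (λ r′ → reduce r′ w) (sym (cancel-∅ r))) (reduce-cancel′ r ∅ w)

  plus-origin : ∀ r w {t} → t ∈ proj₁ (reduce r w) → t ∈ proj₁ r ⊎ (true , t) ∈ w
  plus-origin r [] t∈ = inj₁ t∈
  plus-origin (ps , ms) ((true , u) ∷ w) t∈ with plus-origin (u ∷ ps , ms) w t∈
  ... | inj₁ (here refl) = inj₂ (here refl)
  ... | inj₁ (there t∈ps) = inj₁ t∈ps
  ... | inj₂ t∈w = inj₂ (there t∈w)
  plus-origin ([] , ms) ((false , u) ∷ w) t∈ with plus-origin ([] , u ∷ ms) w t∈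
  ... | inj₂ t∈w = inj₂ (there t∈w)
  plus-origin (_ ∷ ps , ms) ((false , u) ∷ w) t∈ with plus-origin (ps , ms) w t∈
  ... | inj₁ t∈ps = inj₁ (there t∈ps)
  ... | inj₂ t∈w = inj₂ (there t∈w)

  minus-origin : ∀ r w {t} → t ∈ proj₂ (reduce r w) → t ∈ proj₂ r ⊎ (false , t) ∈ w
  minus-origin r [] t∈ = inj₁ t∈
  minus-origin (ps , ms) ((true , u) ∷ w) t∈ with minus-origin (u ∷ ps , ms) w t∈
  ... | inj₁ t∈ms = inj₁ t∈ms
  ... | inj₂ t∈w = inj₂ (there t∈w)
  minus-origin ([] , ms) ((false , u) ∷ w) t∈ with minus-origin ([] , u ∷ ms) w t∈
  ... | inj₁ (here refl) = inj₂ (here refl)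
  ... | inj₁ (there t∈ms) = inj₁ t∈ms
  ... | inj₂ t∈w = inj₂ (there t∈w)
  minus-origin (_ ∷ ps , ms) ((false , u) ∷ w) t∈ with minus-origin (ps , ms) w t∈
  ... | inj₁ t∈ms = inj₁ t∈ms
  ... | inj₂ t∈w = inj₂ (there t∈w)

  Avoids : T → List (Bool × T) → Set
  Avoids t = All (λ x → proj₂ x ≢ t)

  avoids-∉ : ∀ {t w} b → Avoids t w → ¬ (b , t) ∈ w
  avoids-∉ b avoid t∈w = All.lookup avoid t∈w refl

  plus-fresh : ∀ r w {t} → ¬ t ∈ proj₁ r → ¬ (true , t) ∈ w → ¬ t ∈ proj₁ (reduce r w)
  plus-fresh r w t∉r t∉w t∈ = [ t∉r , t∉w ]′ (plus-origin r w t∈)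

  minus-fresh : ∀ r w {t} → ¬ t ∈ proj₂ r → ¬ (false , t) ∈ w → ¬ t ∈ proj₂ (reduce r w)
  minus-fresh r w t∉r t∉w t∈ = [ t∉r , t∉w ]′ (minus-origin r w t∈)

module _ {T U : Set} (σ : T → U) where

  mapᵣ : Reduced T → Reduced U
  mapᵣ (ps , ms) = map σ ps , map σ ms

  relabel : List (Bool × T) → List (Bool × U)
  relabel = map (map₂ σ)

  step-relabel : ∀ r x → step (mapᵣ r) (map₂ σ x) ≡ mapᵣ (step r x)
  step-relabel (ps , ms)     (true , t)  = refl
  step-relabel ([] , ms)     (false , t) = refl
  step-relabel (_ ∷ ps , ms) (false , t) = refl

  reduce-relabel : ∀ r w → reduce (mapᵣ r) (relabel w) ≡ mapᵣ (reduce r w)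
  reduce-relabel r []      = refl
  reduce-relabel r (x ∷ w) rewrite step-relabel r x = reduce-relabel (step r x) w

module _ {T : Set} where

  signs : Bool → Bool → T → List (Bool × T)
  signs x y t = (if x then [ (true , t) ] else []) ++ (if y then [ (false , t) ] else [])

  private
    last-drop-∈-tail : ∀ k x y (zs : List T) {z} → last (drop k (x ∷ y ∷ zs)) ≡ just z → z ∈ y ∷ zs
    last-drop-∈-tail zero    x y zs e = last-∈ e
    last-drop-∈-tail (suc k) x y zs e = Sublist.lookup (drop-⊆ k (y ∷ zs)) (last-∈ e)

    fresh-∅ : ∀ w {t : T} → Avoids t w → ¬ t ∈ proj₁ (reduce ∅ w) × ¬ t ∈ proj₂ (reduce ∅ w)
    fresh-∅ w avoid = plus-fresh ∅ w (λ ()) (avoids-∉ true avoid) , minus-fresh ∅ w (λ ()) (avoids-∉ false avoid)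

  -- In the lemmas below a factor t (or two factors a, b) sits between a prefix,
  -- already reduced to r, and a suffix w in which it does not occur.

  lowering-signs : ∀ r x y t w → ¬ t ∈ proj₁ r → Avoids t w →
    t ∈ proj₁ (reduce (reduce r (signs x y t)) w) → x ≡ true × y ≡ false
  lowering-signs r true  false t w t∉r avoid t∈ = refl , refl
  lowering-signs r true  true  t w t∉r avoid t∈ =
    ⊥-elim (plus-fresh r w t∉r (avoids-∉ true avoid) t∈)
  lowering-signs r false true  t w t∉r avoid t∈ =
    ⊥-elim (plus-fresh r ((false , t) ∷ w) t∉r (λ { (there t∈w) → avoids-∉ true avoid t∈w }) t∈)
  lowering-signs r false false t w t∉r avoid t∈ =
    ⊥-elim (plus-fresh r w t∉r (avoids-∉ true avoid) t∈)

  raising-signs : ∀ r x y t w → ¬ t ∈ proj₂ r → Avoids t w →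
    t ∈ proj₂ (reduce (reduce r (signs x y t)) w) → x ≡ false × y ≡ true
  raising-signs r false true  t w t∉r avoid t∈ = refl , refl
  raising-signs r true  true  t w t∉r avoid t∈ =
    ⊥-elim (minus-fresh r w t∉r (avoids-∉ false avoid) t∈)
  raising-signs r true  false t w t∉r avoid t∈ =
    ⊥-elim (minus-fresh r ((true , t) ∷ w) t∉r (λ { (there t∈w) → avoids-∉ false avoid t∈w }) t∈)
  raising-signs r false false t w t∉r avoid t∈ =
    ⊥-elim (minus-fresh r w t∉r (avoids-∉ false avoid) t∈)

  lowering⇒raising : ∀ r t w → ¬ t ∈ proj₁ r → Avoids t w →
    last (proj₁ (reduce (step r (true , t)) w)) ≡ just t →
    head (proj₂ (reduce (step r (false , t)) w)) ≡ just t
  lowering⇒raising (ps , ms) t w t∉ps avoid e =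
    subst (λ r → head (proj₂ r) ≡ just t) (sym (reduce-cancel (step (ps , ms) (false , t)) w))
      (via-cancel ps (reduce ∅ w) t∉ps (proj₁ (fresh-∅ w avoid))
        (subst (λ r → last (proj₁ r) ≡ just t) (reduce-cancel (t ∷ ps , ms) w) e))
    where
    via-cancel : ∀ ps r′ → ¬ t ∈ ps → ¬ t ∈ proj₁ r′ →
      last (proj₁ (cancel (t ∷ ps , ms) r′)) ≡ just t →
      head (proj₂ (cancel (step (ps , ms) (false , t)) r′)) ≡ just t
    via-cancel []       (qs , [])     _    _    _ = refl
    via-cancel []       (qs , _ ∷ ns) _    t∉qs e with last-++ qs _ e
    ... | inj₁ t∈qs = ⊥-elim (t∉qs t∈qs)
    ... | inj₂ e′ with Sublist.lookup (drop-⊆ (length ns) []) (last-∈ e′)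
    ...   | ()
    via-cancel (p ∷ ps) (qs , ns)     t∉ps t∉qs e with last-++ qs _ e
    ... | inj₁ t∈qs = ⊥-elim (t∉qs t∈qs)
    ... | inj₂ e′   = ⊥-elim (t∉ps (last-drop-∈-tail (length ns) t p ps e′))

  raising⇒lowering : ∀ r t w → ¬ t ∈ proj₂ r → Avoids t w →
    head (proj₂ (reduce (step r (false , t)) w)) ≡ just t →
    last (proj₁ (reduce (step r (true , t)) w)) ≡ just t
  raising⇒lowering (ps , ms) t w t∉ms avoid e =
    subst (λ r → last (proj₁ r) ≡ just t) (sym (reduce-cancel (t ∷ ps , ms) w))
      (via-cancel ps (reduce ∅ w) (proj₂ (fresh-∅ w avoid))
        (subst (λ r → head (proj₂ r) ≡ just t) (reduce-cancel (step (ps , ms) (false , t)) w) e))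
    where
    via-cancel : ∀ ps r′ → ¬ t ∈ proj₂ r′ →
      head (proj₂ (cancel (step (ps , ms) (false , t)) r′)) ≡ just t →
      last (proj₁ (cancel (t ∷ ps , ms) r′)) ≡ just t
    via-cancel []       (qs , [])     _    _    = last-∷ʳ qs t
    via-cancel []       (qs , n ∷ ns) t∉ns refl = ⊥-elim (t∉ns (here refl))
    via-cancel (_ ∷ ps) (qs , ns)     t∉ns e with head-++ (take (length ns ∸ length ps) ns) ms e
    ... | inj₁ t∈ns = ⊥-elim (t∉ns (Sublist.lookup (take-⊆ _ ns) t∈ns))
    ... | inj₂ e′   = ⊥-elim (t∉ms (head-∈ e′))

  second-plus-not-lowering : ∀ r a b w → a ≢ b → ¬ b ∈ proj₁ r → Avoids b w →
    last (proj₁ (reduce (reduce r (signs true false a ++ signs true false b)) w)) ≢ just b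
  second-plus-not-lowering (ps , ms) a b w a≢b b∉ps avoid e =
    via-cancel (reduce ∅ w) (proj₁ (fresh-∅ w avoid))
      (subst (λ r → last (proj₁ r) ≡ just b) (reduce-cancel (b ∷ a ∷ ps , ms) w) e)
    where
    via-cancel : ∀ r′ → ¬ b ∈ proj₁ r′ → last (proj₁ (cancel (b ∷ a ∷ ps , ms) r′)) ≢ just b
    via-cancel (qs , ns) b∉qs e′ with last-++ qs _ e′
    ... | inj₁ b∈qs = b∉qs b∈qs
    ... | inj₂ e″ with last-drop-∈-tail (length ns) b a ps e″
    ...   | here b≡a   = a≢b (sym b≡a)
    ...   | there b∈ps = b∉ps b∈ps

  first-minus-not-raising : ∀ r a b w → a ≢ b → ¬ a ∈ proj₂ r → Avoids a w →
    head (proj₂ (reduce (reduce r (signs false true a ++ signs false true b)) w)) ≢ just a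
  first-minus-not-raising (ps , ms) a b w a≢b a∉ms avoid e =
    via-cancel (reduce ∅ w) (proj₂ (fresh-∅ w avoid))
      (subst (λ r → head (proj₂ r) ≡ just a) (reduce-cancel r₀ w) e)
    where
    r₀ = reduce (ps , ms) ((false , a) ∷ (false , b) ∷ [])
    unmatched : ∀ ps → head (proj₂ (reduce (ps , ms) ((false , a) ∷ (false , b) ∷ []))) ≢ just a
    unmatched []           e′ = a≢b (sym (just-injective e′))
    unmatched (_ ∷ [])     e′ = a≢b (sym (just-injective e′))
    unmatched (_ ∷ _ ∷ ps) e′ = a∉ms (head-∈ e′)
    via-cancel : ∀ r′ → ¬ a ∈ proj₂ r′ → head (proj₂ (cancel r₀ r′)) ≢ just a
    via-cancel (qs , ns) a∉ns e′ with head-++ (take (length ns ∸ length (proj₁ r₀)) ns) (proj₂ r₀) e′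
    ... | inj₁ a∈ns = a∉ns (Sublist.lookup (take-⊆ _ ns) a∈ns)
    ... | inj₂ e″   = unmatched ps e″

module _ {T : Set} (σ : T → T) where

  -- Used for the signs old, new of two adjacent factors and σ the transposition of these factors.
  record Relabels (old new : List (Bool × T)) : Set where
    constructor relabels
    field apply : ∀ r → mapᵣ σ r ≡ r → reduce r new ≡ mapᵣ σ (reduce r old)

  relabels-from-relabel : ∀ {old new} → (∀ r → reduce r new ≡ reduce r (relabel σ old)) → Relabels old new
  relabels-from-relabel {old} {new} same = relabels λ r fixed → begin
    reduce r new                       ≡⟨ same r ⟩
    reduce r (relabel σ old)           ≡⟨ cong (λ r′ → reduce r′ (relabel σ old)) (sym fixed) ⟩
    reduce (mapᵣ σ r) (relabel σ old)  ≡⟨ reduce-relabel σ r old ⟩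
    mapᵣ σ (reduce r old)              ∎
    where open ≡-Reasoning

  relabels-sym : (∀ x → σ (σ x) ≡ x) → ∀ {old new} → Relabels old new → Relabels new old
  relabels-sym σσ {old} {new} (relabels rel) = relabels λ r fixed → begin
    reduce r old                        ≡⟨ sym (mapᵣ-σσ (reduce r old)) ⟩
    mapᵣ σ (mapᵣ σ (reduce r old))      ≡⟨ cong (mapᵣ σ) (sym (rel r fixed)) ⟩
    mapᵣ σ (reduce r new)               ∎
    where
    open ≡-Reasoning
    map-σσ : ∀ xs → map σ (map σ xs) ≡ xs
    map-σσ []       = refl
    map-σσ (x ∷ xs) = cong₂ _∷_ (σσ x) (map-σσ xs)
    mapᵣ-σσ : ∀ r → mapᵣ σ (mapᵣ σ r) ≡ r
    mapᵣ-σσ (ps , ms) = cong₂ _,_ (map-σσ ps) (map-σσ ms)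

  module _ {t₁ t₂ : T} (σt₁ : σ t₁ ≡ t₂) (σt₂ : σ t₂ ≡ t₁) where

    -- In the excluded cases a cancelling pair "+-" would turn into "-+", or conversely.
    plus-moves-forward : ∀ y₁ y₂ → ¬ (y₁ ≡ true × y₂ ≡ false) →
      Relabels (signs false y₁ t₁ ++ signs true y₂ t₂) (signs true y₁ t₁ ++ signs false y₂ t₂)
    plus-moves-forward false false _  = relabels-from-relabel λ r → cong (λ t → reduce r [ (true , t) ]) (sym σt₂)
    plus-moves-forward false true  _  = relabels-from-relabel λ r → refl
    plus-moves-forward true  true  _  = relabels-from-relabel λ r → cong (λ t → reduce r [ (false , t) ]) (sym σt₁)
    plus-moves-forward true  false ¬tf = ⊥-elim (¬tf (refl , refl))

    minus-moves-forward : ∀ x₁ x₂ → ¬ (x₁ ≡ false × x₂ ≡ true) →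
      Relabels (signs x₁ false t₁ ++ signs x₂ true t₂) (signs x₁ true t₁ ++ signs x₂ false t₂)
    minus-moves-forward false false _  = relabels-from-relabel λ r → cong (λ t → reduce r [ (false , t) ]) (sym σt₂)
    minus-moves-forward true  true  _  = relabels-from-relabel λ r → cong (λ t → reduce r [ (true , t) ]) (sym σt₁)
    minus-moves-forward true  false _  = relabels-from-relabel λ r → refl
    minus-moves-forward false true ¬ft = ⊥-elim (¬ft (refl , refl))

module _ {A : Set} {P : A → Set} where

  All-reverse : ∀ {xs} → All P xs → All P (reverse xs)
  All-reverse {[]}     []         = []
  All-reverse {x ∷ xs} (px ∷ pxs) rewrite unfold-reverse x xs = ∷ʳ⁺ (All-reverse pxs) px

module _ {A : Set} where

  record OnceIn (t : A) (O : List A) : Set where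
    constructor once
    field
      before after  : List A
      split         : O ≡ before ++ t ∷ after
      before-avoids : All (_≢ t) before
      after-avoids  : All (_≢ t) after

  Avoids₂ : A → A → List A → Set
  Avoids₂ a b = All (λ u → u ≢ a × u ≢ b)

  record AdjacentIn (a b : A) (O : List A) : Set where
    constructor adjacent
    field
      before after  : List A
      split         : O ≡ before ++ a ∷ b ∷ after
      before-avoids : Avoids₂ a b before
      after-avoids  : Avoids₂ a b after

  onceIn-reverse : ∀ {t O} → OnceIn t O → OnceIn t (reverse O)
  onceIn-reverse {t} (once C D refl hC hD) = once (reverse D) (reverse C) eq (All-reverse hD) (All-reverse hC)
    where
    open ≡-Reasoning
    eq : reverse (C ++ t ∷ D) ≡ reverse D ++ t ∷ reverse C
    eq = begin
      reverse (C ++ t ∷ D)          ≡⟨ reverse-++ C (t ∷ D) ⟩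
      reverse (t ∷ D) ++ reverse C  ≡⟨ cong (_++ reverse C) (unfold-reverse t D) ⟩
      (reverse D ∷ʳ t) ++ reverse C ≡⟨ ++-assoc (reverse D) [ t ] (reverse C) ⟩
      reverse D ++ t ∷ reverse C    ∎

  adjacentIn-reverse : ∀ {a b O} → AdjacentIn a b O → AdjacentIn b a (reverse O)
  adjacentIn-reverse {a} {b} (adjacent C D refl hC hD) =
    adjacent (reverse D) (reverse C) eq (All-reverse (All.map swap hD)) (All-reverse (All.map swap hC))
    where
    open ≡-Reasoning
    eq : reverse (C ++ a ∷ b ∷ D) ≡ reverse D ++ b ∷ a ∷ reverse C
    eq = begin
      reverse (C ++ a ∷ b ∷ D)                ≡⟨ reverse-++ C (a ∷ b ∷ D) ⟩
      reverse (a ∷ b ∷ D) ++ reverse C        ≡⟨ cong (_++ reverse C) (reverse-++ (a ∷ b ∷ []) D) ⟩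
      (reverse D ++ b ∷ a ∷ []) ++ reverse C  ≡⟨ ++-assoc (reverse D) (b ∷ a ∷ []) (reverse C) ⟩
      reverse D ++ b ∷ a ∷ reverse C          ∎

allFin-suc : ∀ n → allFin (suc n) ≡ fzero ∷ map fsuc (allFin n)
allFin-suc n = cong (fzero ∷_) (sym (map-tabulate id fsuc))

fsuc-avoids : ∀ {n} {t : Fin n} {C} → All (_≢ t) C → All (_≢ fsuc t) (map fsuc C)
fsuc-avoids hC = map⁺ (All.map (λ u≢t → u≢t ∘ suc-injective) hC)

fsuc-avoids₂ : ∀ {n} {a b : Fin n} {C} → Avoids₂ a b C → Avoids₂ (fsuc a) (fsuc b) (map fsuc C)
fsuc-avoids₂ hC = map⁺ (All.map (λ (u≢a , u≢b) → u≢a ∘ suc-injective , u≢b ∘ suc-injective) hC)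

onceIn-allFin : ∀ {n} (t : Fin n) → OnceIn t (allFin n)
onceIn-allFin {suc n} fzero =
  once [] (map fsuc (allFin n)) (allFin-suc n) [] (map⁺ (All.tabulate λ _ ()))
onceIn-allFin {suc n} (fsuc t) with onceIn-allFin t
... | once C D eq hC hD =
  once (fzero ∷ map fsuc C) (map fsuc D)
    (trans (allFin-suc n) (cong (fzero ∷_) (trans (cong (map fsuc) eq) (map-++ fsuc C (t ∷ D)))))
    ((λ ()) ∷ fsuc-avoids hC) (fsuc-avoids hD)

onceIn-reverse-allFin : ∀ {n} (t : Fin n) → OnceIn t (reverse (allFin n))
onceIn-reverse-allFin t = onceIn-reverse (onceIn-allFin t)

adjacentIn-allFin : ∀ {m} (i : Fin m) → AdjacentIn (inject₁ i) (fsuc i) (allFin (suc m))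
adjacentIn-allFin {suc m} fzero =
  adjacent [] (map fsuc (map fsuc (allFin m)))
    (trans (allFin-suc (suc m)) (cong (λ O → fzero ∷ map fsuc O) (allFin-suc m)))
    [] (map⁺ (map⁺ (All.tabulate λ _ → (λ ()) , (λ ()))))
adjacentIn-allFin {suc m} (fsuc i) with adjacentIn-allFin i
... | adjacent C D eq hC hD =
  adjacent (fzero ∷ map fsuc C) (map fsuc D)
    (trans (allFin-suc (suc m)) (cong (fzero ∷_) (trans (cong (map fsuc) eq) (map-++ fsuc C _))))
    (((λ ()) , (λ ())) ∷ fsuc-avoids₂ hC) (fsuc-avoids₂ hD)

lookup-ext : ∀ {A : Set} {n} {xs ys : Vec A n} → (∀ k → lookup xs k ≡ lookup ys k) → xs ≡ ys
lookup-ext {xs = xs} {ys} same =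
  trans (sym (tabulate∘lookup xs)) (trans (tabulate-cong same) (tabulate∘lookup ys))

module _ {A : Set} where

  entry : ∀ {m n} → Vec (Vec A n) m → Fin m → Fin n → A
  entry X t k = lookup (lookup X t) k

  entry-ext : ∀ {m n} {X Y : Vec (Vec A n) m} → (∀ t k → entry X t k ≡ entry Y t k) → X ≡ Y
  entry-ext same = lookup-ext (λ t → lookup-ext (same t))

  lookup-transpose : ∀ {m n} (X : Vec (Vec A n) m) k → lookup (transpose X) k ≡ Vec.map (λ r → lookup r k) X
  lookup-transpose Vec.[]         k = lookup-replicate k Vec.[]
  lookup-transpose (r Vec.∷ X) k = begin
    lookup (Vec.replicate _ Vec._∷_ ⊛ r ⊛ transpose X) k
      ≡⟨ lookup-⊛ k (Vec.replicate _ Vec._∷_ ⊛ r) (transpose X) ⟩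
    lookup (Vec.replicate _ Vec._∷_ ⊛ r) k (lookup (transpose X) k)
      ≡⟨ cong (λ f → f (lookup (transpose X) k)) (lookup-⊛ k (Vec.replicate _ Vec._∷_) r) ⟩
    lookup (Vec.replicate _ Vec._∷_) k (lookup r k) (lookup (transpose X) k)
      ≡⟨ cong (λ f → f (lookup r k) (lookup (transpose X) k)) (lookup-replicate k Vec._∷_) ⟩
    lookup r k Vec.∷ lookup (transpose X) k
      ≡⟨ cong (lookup r k Vec.∷_) (lookup-transpose X k) ⟩
    lookup r k Vec.∷ Vec.map (λ r → lookup r k) X ∎
    where open ≡-Reasoning

  entry-transpose : ∀ {m n} (X : Vec (Vec A n) m) t k → entry (transpose X) k t ≡ entry X t k
  entry-transpose X t k =
    trans (cong (λ v → lookup v t) (lookup-transpose X k)) (lookup-map t (λ r → lookup r k) X)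

  transpose-transpose : ∀ {m n} (X : Vec (Vec A n) m) → transpose (transpose X) ≡ X
  transpose-transpose X = entry-ext (λ t k → trans (entry-transpose (transpose X) k t) (entry-transpose X t k))

Matrix : ℕ → ℕ → Set
Matrix m n = Vec (Vec Bool n) m

record RowMove {m n} (k₁ k₂ : Fin n) (t : Fin m) (x₁ x₂ : Bool) (X Y : Matrix m n) : Set where
  constructor rowMove
  field
    at₁         : entry Y t k₁ ≡ x₁
    at₂         : entry Y t k₂ ≡ x₂
    rest-of-row : ∀ k → k ≢ k₁ → k ≢ k₂ → entry Y t k ≡ entry X t k
    other-rows  : ∀ u → u ≢ t → lookup Y u ≡ lookup X u

module _ {m n : ℕ} {k₁ k₂ : Fin n} where

  rowMove-update : k₁ ≢ k₂ → ∀ (X : Matrix m n) t x₁ x₂ →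
    RowMove k₁ k₂ t x₁ x₂ X (X [ t ]≔ ((lookup X t [ k₁ ]≔ x₁) [ k₂ ]≔ x₂))
  rowMove-update k₁≢k₂ X t x₁ x₂ = rowMove
    (trans (row-t k₁) (trans (lookup∘update′ k₁≢k₂ row x₂) (lookup∘update k₁ (lookup X t) x₁)))
    (trans (row-t k₂) (lookup∘update k₂ row x₂))
    (λ k k≢k₁ k≢k₂ → trans (row-t k)
                       (trans (lookup∘update′ k≢k₂ row x₂) (lookup∘update′ k≢k₁ (lookup X t) x₁)))
    (λ u u≢t → lookup∘update′ u≢t X _)
    where
    row = lookup X t [ k₁ ]≔ x₁
    row-t : ∀ k → entry (X [ t ]≔ (row [ k₂ ]≔ x₂)) t k ≡ lookup (row [ k₂ ]≔ x₂) k
    row-t k = cong (λ r → lookup r k) (lookup∘update t X _)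

  rowMove-swap : ∀ {t x₁ x₂} {X Y : Matrix m n} → RowMove k₁ k₂ t x₁ x₂ X Y → RowMove k₂ k₁ t x₂ x₁ X Y
  rowMove-swap (rowMove at₁ at₂ rest others) = rowMove at₂ at₁ (λ k k≢k₂ k≢k₁ → rest k k≢k₁ k≢k₂) others

  rowMoves-restore : ∀ {t x₁ x₂ y₁ y₂} {X Y Z : Matrix m n} →
    RowMove k₁ k₂ t x₁ x₂ X Y → RowMove k₁ k₂ t y₁ y₂ Y Z → entry X t k₁ ≡ y₁ → entry X t k₂ ≡ y₂ → Z ≡ X
  rowMoves-restore {t} {X = X} {Z = Z} (rowMove _ _ rest others) (rowMove at₁′ at₂′ rest′ others′) e₁ e₂ =
    entry-ext same
    where
    same : ∀ u k → entry Z u k ≡ entry X u k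
    same u k with u ≟ t
    ... | no u≢t = cong (λ r → lookup r k) (trans (others′ u u≢t) (others u u≢t))
    ... | yes refl with k ≟ k₁ | k ≟ k₂
    ...   | yes refl | _        = trans at₁′ (sym e₁)
    ...   | no _     | yes refl = trans at₂′ (sym e₂)
    ...   | no k≢k₁  | no k≢k₂  = trans (rest′ k k≢k₁ k≢k₂) (rest k k≢k₁ k≢k₂)

module _ {m n : ℕ} {k₁ k₂ : Fin n} {t : Fin m} {x₁ x₂ : Bool} where

  rowMove-untouched : ∀ {X Y} → RowMove k₁ k₂ t x₁ x₂ X Y → ∀ {u k} → u ≢ t ⊎ (k ≢ k₁ × k ≢ k₂) →
    entry Y u k ≡ entry X u k
  rowMove-untouched M {u} {k} (inj₁ u≢t) = cong (λ r → lookup r k) (RowMove.other-rows M u u≢t)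
  rowMove-untouched M {u} {k} (inj₂ (k≢k₁ , k≢k₂)) with u ≟ t
  ... | yes refl = RowMove.rest-of-row M k k≢k₁ k≢k₂
  ... | no u≢t   = cong (λ r → lookup r k) (RowMove.other-rows M u u≢t)

  rowMove-pointwise : ∀ {X Y Z W} → RowMove k₁ k₂ t x₁ x₂ X Y → RowMove k₁ k₂ t x₁ x₂ Z W →
    ∀ {u k} → entry X u k ≡ entry Z u k → entry Y u k ≡ entry W u k
  rowMove-pointwise M M′ {u} {k} e with u ≟ t | k ≟ k₁ | k ≟ k₂
  ... | no u≢t   | _        | _        =
    trans (rowMove-untouched M (inj₁ u≢t)) (trans e (sym (rowMove-untouched M′ (inj₁ u≢t))))
  ... | yes refl | yes refl | _        = trans (RowMove.at₁ M) (sym (RowMove.at₁ M′))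
  ... | yes refl | no _     | yes refl = trans (RowMove.at₂ M) (sym (RowMove.at₂ M′))
  ... | yes refl | no k≢k₁  | no k≢k₂  =
    trans (rowMove-untouched M (inj₂ (k≢k₁ , k≢k₂)))
          (trans e (sym (rowMove-untouched M′ (inj₂ (k≢k₁ , k≢k₂)))))

record ColMove {m n} (r₁ r₂ : Fin m) (k : Fin n) (y₁ y₂ : Bool) (X Y : Matrix m n) : Set where
  constructor colMove
  field
    at₁         : entry Y r₁ k ≡ y₁
    at₂         : entry Y r₂ k ≡ y₂
    rest-of-col : ∀ u → u ≢ r₁ → u ≢ r₂ → entry Y u k ≡ entry X u k
    other-cols  : ∀ u k′ → k′ ≢ k → entry Y u k′ ≡ entry X u k′

module _ {m n : ℕ} {r₁ r₂ : Fin m} {k : Fin n} {y₁ y₂ : Bool} where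

  rowMove-transpose : ∀ {X : Matrix m n} {Y} → RowMove r₁ r₂ k y₁ y₂ (transpose X) Y →
    ColMove r₁ r₂ k y₁ y₂ X (transpose Y)
  rowMove-transpose {X} {Y} (rowMove at₁ at₂ rest others) = colMove
    (trans (entry-transpose Y k r₁) at₁)
    (trans (entry-transpose Y k r₂) at₂)
    (λ u u≢r₁ u≢r₂ → trans (entry-transpose Y k u) (trans (rest u u≢r₁ u≢r₂) (entry-transpose X u k)))
    (λ u k′ k′≢k → trans (entry-transpose Y k′ u)
                     (trans (cong (λ r → lookup r u) (others k′ k′≢k)) (entry-transpose X u k′)))

  colMove-untouched : ∀ {X Y} → ColMove r₁ r₂ k y₁ y₂ X Y → ∀ {u k′} → (u ≢ r₁ × u ≢ r₂) ⊎ k′ ≢ k →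
    entry Y u k′ ≡ entry X u k′
  colMove-untouched M {u} {k′} (inj₂ k′≢k) = ColMove.other-cols M u k′ k′≢k
  colMove-untouched M {u} {k′} (inj₁ (u≢r₁ , u≢r₂)) with k′ ≟ k
  ... | yes refl = ColMove.rest-of-col M u u≢r₁ u≢r₂
  ... | no k′≢k  = ColMove.other-cols M u k′ k′≢k

  colMove-pointwise : ∀ {X Y Z W} → ColMove r₁ r₂ k y₁ y₂ X Y → ColMove r₁ r₂ k y₁ y₂ Z W →
    ∀ {u k′} → entry X u k′ ≡ entry Z u k′ → entry Y u k′ ≡ entry W u k′
  colMove-pointwise M M′ {u} {k′} e with k′ ≟ k | u ≟ r₁ | u ≟ r₂
  ... | no k′≢k  | _        | _        =
    trans (colMove-untouched M (inj₂ k′≢k)) (trans e (sym (colMove-untouched M′ (inj₂ k′≢k))))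
  ... | yes refl | yes refl | _        = trans (ColMove.at₁ M) (sym (ColMove.at₁ M′))
  ... | yes refl | no _     | yes refl = trans (ColMove.at₂ M) (sym (ColMove.at₂ M′))
  ... | yes refl | no u≢r₁  | no u≢r₂  =
    trans (colMove-untouched M (inj₁ (u≢r₁ , u≢r₂)))
          (trans e (sym (colMove-untouched M′ (inj₁ (u≢r₁ , u≢r₂)))))

row-col-moves-commute : ∀ {m n} {k₁ k₂ k : Fin n} {r₁ r₂ t : Fin m} {x₁ x₂ y₁ y₂}
  (Fm Gm : Matrix m n → Matrix m n) →
  (∀ Z → RowMove k₁ k₂ t x₁ x₂ Z (Fm Z)) → (∀ Z → ColMove r₁ r₂ k y₁ y₂ Z (Gm Z)) →
  (t ≢ r₁ × t ≢ r₂) ⊎ (k ≢ k₁ × k ≢ k₂) → ∀ X → Gm (Fm X) ≡ Fm (Gm X)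
row-col-moves-commute {k₁ = k₁} {k₂} {k} {r₁} {r₂} {t} Fm Gm F G disjoint X = entry-ext cell
  where
  G-untouched : ∀ {u k′} → (u ≢ r₁ × u ≢ r₂) ⊎ k′ ≢ k → entry (Gm (Fm X)) u k′ ≡ entry (Fm (Gm X)) u k′
  G-untouched h = trans (colMove-untouched (G (Fm X)) h)
                        (rowMove-pointwise (F X) (F (Gm X)) (sym (colMove-untouched (G X) h)))
  F-untouched : ∀ {u k′} → u ≢ t ⊎ (k′ ≢ k₁ × k′ ≢ k₂) → entry (Gm (Fm X)) u k′ ≡ entry (Fm (Gm X)) u k′
  F-untouched h = trans (colMove-pointwise (G (Fm X)) (G X) (rowMove-untouched (F X) h))
                        (sym (rowMove-untouched (F (Gm X)) h))
  in-column : (t ≢ r₁ × t ≢ r₂) ⊎ (k ≢ k₁ × k ≢ k₂) → ∀ {u} → u ≡ r₁ ⊎ u ≡ r₂ → u ≢ t ⊎ (k ≢ k₁ × k ≢ k₂)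
  in-column (inj₂ k∉)             _  = inj₂ k∉
  in-column (inj₁ (t≢r₁ , t≢r₂)) u∈ = inj₁ λ { refl → [ t≢r₁ , t≢r₂ ]′ u∈ }
  cell : ∀ u k′ → entry (Gm (Fm X)) u k′ ≡ entry (Fm (Gm X)) u k′
  cell u k′ with k′ ≟ k | u ≟ r₁ | u ≟ r₂
  ... | no k′≢k  | _       | _       = G-untouched (inj₂ k′≢k)
  ... | yes _    | no u≢r₁ | no u≢r₂ = G-untouched (inj₁ (u≢r₁ , u≢r₂))
  ... | yes refl | yes u≡r₁ | _      = F-untouched (in-column disjoint (inj₁ u≡r₁))
  ... | yes refl | no _    | yes u≡r₂ = F-untouched (in-column disjoint (inj₂ u≡r₂))

card-remove : ∀ {n} (r : Subset n) a → lookup r a ≡ true → suc ∣ r [ a ]≔ false ∣ ≡ ∣ r ∣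
card-remove (_ Vec.∷ r)     fzero    refl = refl
card-remove (true Vec.∷ r)  (fsuc a) e    = cong suc (card-remove r a e)
card-remove (false Vec.∷ r) (fsuc a) e    = card-remove r a e

card-insert : ∀ {n} (r : Subset n) a → lookup r a ≡ false → ∣ r [ a ]≔ true ∣ ≡ suc ∣ r ∣
card-insert (_ Vec.∷ r)     fzero    refl = refl
card-insert (true Vec.∷ r)  (fsuc a) e    = cong suc (card-insert r a e)
card-insert (false Vec.∷ r) (fsuc a) e    = card-insert r a e

card-move : ∀ {n} (r : Subset n) {a b} → a ≢ b → lookup r a ≡ true → lookup r b ≡ false →
            ∣ (r [ a ]≔ false) [ b ]≔ true ∣ ≡ ∣ r ∣
card-move r a≢b ra rb =
  trans (card-insert (r [ _ ]≔ false) _ (trans (lookup∘update′ (a≢b ∘ sym) r false) rb)) (card-remove r _ ra)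

inject₁≢fsuc : ∀ {m} (i : Fin m) → inject₁ i ≢ fsuc i
inject₁≢fsuc fzero    ()
inject₁≢fsuc (fsuc i) e = inject₁≢fsuc i (suc-injective e)

module _ {n : ℕ} {a b : Fin n} where

  transposition-fixes : ∀ {u} → u ≢ a × u ≢ b → PC.transpose a b u ≡ u
  transposition-fixes {u} (u≢a , u≢b) with u ≟ a
  ... | yes u≡a = ⊥-elim (u≢a u≡a)
  ... | no _ with u ≟ b
  ...   | yes u≡b = ⊥-elim (u≢b u≡b)
  ...   | no _    = refl

  transposition-first : PC.transpose a b a ≡ b
  transposition-first with a ≟ a
  ... | yes _   = refl
  ... | no a≢a = ⊥-elim (a≢a refl)

  transposition-second : PC.transpose a b b ≡ a
  transposition-second with b ≟ a
  ... | yes b≡a = b≡a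
  ... | no _ with b ≟ b
  ...   | yes _   = refl
  ...   | no b≢b = ⊥-elim (b≢b refl)

  transposition-involutive : ∀ u → PC.transpose a b (PC.transpose a b u) ≡ u
  transposition-involutive u with u ≟ a
  ... | yes refl = transposition-second
  ... | no u≢a with u ≟ b
  ...   | yes refl = transposition-first
  ...   | no u≢b   = transposition-fixes (u≢a , u≢b)

module SignatureRule {m p : ℕ} (O : List (Fin p)) (i : Fin m) where

  k₁ k₂ : Fin (suc m)
  k₁ = inject₁ i
  k₂ = fsuc i

  k₁≢k₂ : k₁ ≢ k₂
  k₁≢k₂ = inject₁≢fsuc i

  Mat : Set
  Mat = Matrix p (suc m)

  word : Mat → List (Fin p) → List (Bool × Fin p)
  word X = concatMap (signsAt i X)

  state : Mat → Reduced (Fin p)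
  state X = reduce ∅ (signWord O i X)

  lowerPos-state : ∀ (X : Mat) → lowerPos O i X ≡ last (proj₁ (state X))
  lowerPos-state X =
    trans (cong (firstWith true ∘ reverse) (foldl-push-encode ∅ (signWord O i X)))
          (firstWith-true-reverse-encode (state X))

  raisePos-state : ∀ (X : Mat) → raisePos O i X ≡ head (proj₂ (state X))
  raisePos-state X =
    trans (cong (firstWith false) (foldl-push-encode ∅ (signWord O i X))) (firstWith-false-encode (state X))

  lowerPos-via-state : ∀ (X Y : Mat) → state Y ≡ state X → lowerPos O i Y ≡ lowerPos O i X
  lowerPos-via-state X Y e = trans (lowerPos-state Y) (trans (cong (last ∘ proj₁) e) (sym (lowerPos-state X)))

  raisePos-via-state : ∀ (X Y : Mat) → state Y ≡ state X → raisePos O i Y ≡ raisePos O i X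
  raisePos-via-state X Y e = trans (raisePos-state Y) (trans (cong (head ∘ proj₂) e) (sym (raisePos-state X)))

  Letters : Mat → Fin p → Bool → Bool → Set
  Letters X t x y = entry X t k₁ ≡ x × entry X t k₂ ≡ y

  signsAt-≡ : ∀ (X : Mat) t {x y} → Letters X t x y → signsAt i X t ≡ signs x y t
  signsAt-≡ X t (refl , refl) = refl

  signsAt-avoids : ∀ (X : Mat) {u t} → u ≢ t → Avoids t (signsAt i X u)
  signsAt-avoids X {u} u≢t with entry X u k₁ | entry X u k₂
  ... | true  | true  = u≢t ∷ u≢t ∷ []
  ... | true  | false = u≢t ∷ []
  ... | false | true  = u≢t ∷ []
  ... | false | false = []

  word-avoids : ∀ (X : Mat) {C t} → All (_≢ t) C → Avoids t (word X C)
  word-avoids X []           = []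
  word-avoids X (u≢t ∷ hC) = ++⁺ (signsAt-avoids X u≢t) (word-avoids X hC)

  word-cong : ∀ (X Y : Mat) {C} {P : Fin p → Set} → All P C → (∀ u → P u → signsAt i Y u ≡ signsAt i X u) →
              word Y C ≡ word X C
  word-cong X Y []        same = refl
  word-cong X Y (pu ∷ pC) same = cong₂ _++_ (same _ pu) (word-cong X Y pC same)

  state-cong : ∀ (X Y : Mat) → (∀ u → signsAt i Y u ≡ signsAt i X u) → state Y ≡ state X
  state-cong X Y same = cong (reduce ∅ ∘ List.concat) (map-cong same O)

  state-around : ∀ (X : Mat) {C D t} → O ≡ C ++ t ∷ D →
    state X ≡ reduce (reduce (reduce ∅ (word X C)) (signsAt i X t)) (word X D)
  state-around X {C} {D} {t} refl = begin
    reduce ∅ (word X (C ++ t ∷ D))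
      ≡⟨ cong (reduce ∅) (concatMap-++ (signsAt i X) C (t ∷ D)) ⟩
    reduce ∅ (word X C ++ signsAt i X t ++ word X D)
      ≡⟨ foldl-++ step ∅ (word X C) _ ⟩
    reduce (reduce ∅ (word X C)) (signsAt i X t ++ word X D)
      ≡⟨ foldl-++ step (reduce ∅ (word X C)) (signsAt i X t) (word X D) ⟩
    reduce (reduce (reduce ∅ (word X C)) (signsAt i X t)) (word X D) ∎
    where open ≡-Reasoning

  state-around₂ : ∀ (X : Mat) {C D a b} → O ≡ C ++ a ∷ b ∷ D →
    state X ≡ reduce (reduce (reduce ∅ (word X C)) (signsAt i X a ++ signsAt i X b)) (word X D)
  state-around₂ X {C} {D} {a} {b} refl = begin
    reduce ∅ (word X (C ++ a ∷ b ∷ D))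
      ≡⟨ cong (reduce ∅) (concatMap-++ (signsAt i X) C (a ∷ b ∷ D)) ⟩
    reduce ∅ (word X C ++ signsAt i X a ++ signsAt i X b ++ word X D)
      ≡⟨ cong (λ w → reduce ∅ (word X C ++ w)) (sym (++-assoc (signsAt i X a) (signsAt i X b) (word X D))) ⟩
    reduce ∅ (word X C ++ (signsAt i X a ++ signsAt i X b) ++ word X D)
      ≡⟨ foldl-++ step ∅ (word X C) _ ⟩
    reduce (reduce ∅ (word X C)) ((signsAt i X a ++ signsAt i X b) ++ word X D)
      ≡⟨ foldl-++ step (reduce ∅ (word X C)) (signsAt i X a ++ signsAt i X b) (word X D) ⟩
    reduce (reduce (reduce ∅ (word X C)) (signsAt i X a ++ signsAt i X b)) (word X D) ∎
    where open ≡-Reasoning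

  lower raise : Fin p → Mat → Mat
  lower t X = X [ t ]≔ ((lookup X t [ k₁ ]≔ false) [ k₂ ]≔ true)
  raise t X = X [ t ]≔ ((lookup X t [ k₂ ]≔ false) [ k₁ ]≔ true)

  lower-rowMove : ∀ t (X : Mat) → RowMove k₁ k₂ t false true X (lower t X)
  lower-rowMove t X = rowMove-update k₁≢k₂ X t false true

  raise-rowMove : ∀ t (X : Mat) → RowMove k₁ k₂ t true false X (raise t X)
  raise-rowMove t X = rowMove-swap (rowMove-update (k₁≢k₂ ∘ sym) X t false true)

  rowMove-signsAt : ∀ {t x₁ x₂} {X Y : Mat} → RowMove k₁ k₂ t x₁ x₂ X Y →
                    ∀ u → u ≢ t → signsAt i Y u ≡ signsAt i X u
  rowMove-signsAt M u u≢t = cong (λ r → signs (lookup r k₁) (lookup r k₂) u) (RowMove.other-rows M u u≢t)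

  module _ (onceIn : ∀ t → OnceIn t O) where

    private
      prefix-fresh : ∀ X {C t} → All (_≢ t) C →
        ¬ t ∈ proj₁ (reduce ∅ (word X C)) × ¬ t ∈ proj₂ (reduce ∅ (word X C))
      prefix-fresh X hC = plus-fresh ∅ _ (λ ()) (avoids-∉ true (word-avoids X hC))
                        , minus-fresh ∅ _ (λ ()) (avoids-∉ false (word-avoids X hC))

      state-at : ∀ (X : Mat) {C D t x₁ x₂} → O ≡ C ++ t ∷ D → Letters X t x₁ x₂ →
        state X ≡ reduce (reduce (reduce ∅ (word X C)) (signs x₁ x₂ t)) (word X D)
      state-at X {C} {D} eq letters =
        trans (state-around X eq)
              (cong (λ w → reduce (reduce (reduce ∅ (word X C)) w) (word X D)) (signsAt-≡ X _ letters))

      state-after-move : ∀ {X Y t x₁ x₂} → RowMove k₁ k₂ t x₁ x₂ X Y → ∀ {C D} → O ≡ C ++ t ∷ D →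
        All (_≢ t) C → All (_≢ t) D →
        state Y ≡ reduce (reduce (reduce ∅ (word X C)) (signs x₁ x₂ t)) (word X D)
      state-after-move {X} {Y} {t} {x₁} {x₂} M {C} {D} eq hC hD =
        trans (state-at Y eq (RowMove.at₁ M , RowMove.at₂ M))
          (cong₂ (λ wC wD → reduce (reduce (reduce ∅ wC) (signs x₁ x₂ t)) wD)
                 (word-cong X Y hC (rowMove-signsAt M)) (word-cong X Y hD (rowMove-signsAt M)))

    lowerPos-entries : ∀ X t → lowerPos O i X ≡ just t → Letters X t true false
    lowerPos-entries X t e with onceIn t
    ... | once C D eq hC hD =
      lowering-signs _ _ _ t (word X D) (proj₁ (prefix-fresh X hC)) (word-avoids X hD)
        (subst (λ r → t ∈ proj₁ r) (state-around X eq) (last-∈ (trans (sym (lowerPos-state X)) e)))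

    raisePos-entries : ∀ X t → raisePos O i X ≡ just t → Letters X t false true
    raisePos-entries X t e with onceIn t
    ... | once C D eq hC hD =
      raising-signs _ _ _ t (word X D) (proj₂ (prefix-fresh X hC)) (word-avoids X hD)
        (subst (λ r → t ∈ proj₂ r) (state-around X eq) (head-∈ (trans (sym (raisePos-state X)) e)))

    lower⇒raisePos : ∀ X t → lowerPos O i X ≡ just t → raisePos O i (lower t X) ≡ just t
    lower⇒raisePos X t e with onceIn t
    ... | once C D eq hC hD =
      trans (raisePos-state (lower t X))
        (subst (λ r → head (proj₂ r) ≡ just t) (sym (state-after-move (lower-rowMove t X) eq hC hD))
          (lowering⇒raising _ t (word X D) (proj₁ (prefix-fresh X hC)) (word-avoids X hD) lowering))
      where
      lowering = subst (λ r → last (proj₁ r) ≡ just t) (state-at X eq (lowerPos-entries X t e))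
                       (trans (sym (lowerPos-state X)) e)

    raise⇒lowerPos : ∀ X t → raisePos O i X ≡ just t → lowerPos O i (raise t X) ≡ just t
    raise⇒lowerPos X t e with onceIn t
    ... | once C D eq hC hD =
      trans (lowerPos-state (raise t X))
        (subst (λ r → last (proj₁ r) ≡ just t) (sym (state-after-move (raise-rowMove t X) eq hC hD))
          (raising⇒lowering _ t (word X D) (proj₂ (prefix-fresh X hC)) (word-avoids X hD) raising))
      where
      raising = subst (λ r → head (proj₂ r) ≡ just t) (state-at X eq (raisePos-entries X t e))
                      (trans (sym (raisePos-state X)) e)

    fOp⇒eOp : ∀ X Y → fOp O i X ≡ just Y → eOp O i Y ≡ just X
    fOp⇒eOp X Y e with lowerPos O i X in low
    fOp⇒eOp X Y refl | just t rewrite lower⇒raisePos X t low =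
      cong just (rowMoves-restore (lower-rowMove t X) (raise-rowMove t (lower t X)) e₁ e₂)
      where
      e₁ = proj₁ (lowerPos-entries X t low)
      e₂ = proj₂ (lowerPos-entries X t low)

    eOp⇒fOp : ∀ X Y → eOp O i X ≡ just Y → fOp O i Y ≡ just X
    eOp⇒fOp X Y e with raisePos O i X in rai
    eOp⇒fOp X Y refl | just t rewrite raise⇒lowerPos X t rai =
      cong just (rowMoves-restore (raise-rowMove t X) (lower-rowMove t (raise t X)) e₁ e₂)
      where
      e₁ = proj₁ (raisePos-entries X t rai)
      e₂ = proj₂ (raisePos-entries X t rai)

    fOp-rowSizes : ∀ X Y → fOp O i X ≡ just Y → Vec.map ∣_∣ Y ≡ Vec.map ∣_∣ X
    fOp-rowSizes X Y e with lowerPos O i X in low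
    fOp-rowSizes X Y refl | just t = lookup-ext same
      where
      same : ∀ u → lookup (Vec.map ∣_∣ (lower t X)) u ≡ lookup (Vec.map ∣_∣ X) u
      same u with u ≟ t
      ... | no u≢t   = trans (lookup-map u ∣_∣ (lower t X))
                         (trans (cong ∣_∣ (lookup∘update′ u≢t X _)) (sym (lookup-map u ∣_∣ X)))
      ... | yes refl = trans (lookup-map t ∣_∣ (lower t X))
                         (trans (cong ∣_∣ (lookup∘update t X _))
                           (trans (card-move (lookup X t) k₁≢k₂ e₁ e₂) (sym (lookup-map t ∣_∣ X))))
        where
        e₁ = proj₁ (lowerPos-entries X t low)
        e₂ = proj₂ (lowerPos-entries X t low)

  module _ {a b : Fin p} (adj : AdjacentIn a b O) where
    open AdjacentIn adj

    private
      prefix : Mat → Reduced (Fin p)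
      prefix X = reduce ∅ (word X before)

      fresh-prefix : ∀ X {t} → Avoids t (word X before) → ¬ t ∈ proj₁ (prefix X) × ¬ t ∈ proj₂ (prefix X)
      fresh-prefix X h = plus-fresh ∅ _ (λ ()) (avoids-∉ true h) , minus-fresh ∅ _ (λ ()) (avoids-∉ false h)

      a∉prefix : ∀ X → ¬ a ∈ proj₁ (prefix X) × ¬ a ∈ proj₂ (prefix X)
      a∉prefix X = fresh-prefix X (word-avoids X (All.map proj₁ before-avoids))

      b∉prefix : ∀ X → ¬ b ∈ proj₁ (prefix X) × ¬ b ∈ proj₂ (prefix X)
      b∉prefix X = fresh-prefix X (word-avoids X (All.map proj₂ before-avoids))

      a∉after : ∀ X → Avoids a (word X after)
      a∉after X = word-avoids X (All.map proj₁ after-avoids)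

      b∉after : ∀ X → Avoids b (word X after)
      b∉after X = word-avoids X (All.map proj₂ after-avoids)

      state-entries : ∀ X {xa ya xb yb} → Letters X a xa ya → Letters X b xb yb →
        state X ≡ reduce (reduce (prefix X) (signs xa ya a ++ signs xb yb b)) (word X after)
      state-entries X la lb = trans (state-around₂ X split)
        (cong (λ w → reduce (reduce (prefix X) w) (word X after)) (cong₂ _++_ (signsAt-≡ X a la) (signsAt-≡ X b lb)))

    ¬lowerPos-cancelled : ∀ X → Letters X a true false → Letters X b false true → lowerPos O i X ≢ just a
    ¬lowerPos-cancelled X la lb e =
      plus-fresh (prefix X) (word X after) (proj₁ (a∉prefix X)) (avoids-∉ true (a∉after X))
        (subst (λ r → a ∈ proj₁ r) (state-entries X la lb) (last-∈ (trans (sym (lowerPos-state X)) e)))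

    ¬raisePos-cancelled : ∀ X → Letters X a true false → Letters X b false true → raisePos O i X ≢ just b
    ¬raisePos-cancelled X la lb e =
      minus-fresh (prefix X) (word X after) (proj₂ (b∉prefix X)) (avoids-∉ false (b∉after X))
        (subst (λ r → b ∈ proj₂ r) (state-entries X la lb) (head-∈ (trans (sym (raisePos-state X)) e)))

    module _ (a≢b : a ≢ b) where

      ¬lowerPos-second-plus : ∀ X → Letters X a true false → Letters X b true false → lowerPos O i X ≢ just b
      ¬lowerPos-second-plus X la lb e =
        second-plus-not-lowering (prefix X) a b (word X after) a≢b (proj₁ (b∉prefix X)) (b∉after X)
          (subst (λ r → last (proj₁ r) ≡ just b) (state-entries X la lb) (trans (sym (lowerPos-state X)) e))

      ¬raisePos-first-minus : ∀ X → Letters X a false true → Letters X b false true → raisePos O i X ≢ just a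
      ¬raisePos-first-minus X la lb e =
        first-minus-not-raising (prefix X) a b (word X after) a≢b (proj₂ (a∉prefix X)) (a∉after X)
          (subst (λ r → head (proj₂ r) ≡ just a) (state-entries X la lb) (trans (sym (raisePos-state X)) e))

    private
      τ : Fin p → Fin p
      τ = PC.transpose a b

      word-relabel : ∀ X {E} → Avoids₂ a b E → relabel τ (word X E) ≡ word X E
      word-relabel X {[]}    []       = refl
      word-relabel X {u ∷ E} (h ∷ hE) = trans (map-++ (map₂ τ) (signsAt i X u) (word X E))
        (cong₂ _++_ (relabel-signs (entry X u k₁) (entry X u k₂) (transposition-fixes h)) (word-relabel X hE))
        where
        relabel-signs : ∀ x y {u} → τ u ≡ u → relabel τ (signs x y u) ≡ signs x y u
        relabel-signs true  true  τu = cong (λ v → (true , v) ∷ (false , v) ∷ []) τu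
        relabel-signs true  false τu = cong (λ v → [ (true , v) ]) τu
        relabel-signs false true  τu = cong (λ v → [ (false , v) ]) τu
        relabel-signs false false τu = refl

    state-relabel : ∀ X Y → (∀ u → u ≢ a × u ≢ b → signsAt i Y u ≡ signsAt i X u) →
      Relabels τ (signsAt i X a ++ signsAt i X b) (signsAt i Y a ++ signsAt i Y b) →
      state Y ≡ mapᵣ τ (state X)
    state-relabel X Y same rel = begin
      state Y
        ≡⟨ state-around₂ Y split ⟩
      reduce (reduce (prefix Y) midY) (word Y after)
        ≡⟨ cong₂ (λ wC wD → reduce (reduce (reduce ∅ wC) midY) wD)
                 (word-cong X Y before-avoids same) (word-cong X Y after-avoids same) ⟩
      reduce (reduce (prefix X) midY) (word X after)
        ≡⟨ cong (λ r → reduce r (word X after)) (Relabels.apply rel (prefix X) prefix-fixed) ⟩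
      reduce (mapᵣ τ (reduce (prefix X) midX)) (word X after)
        ≡⟨ cong (reduce (mapᵣ τ (reduce (prefix X) midX))) (sym (word-relabel X after-avoids)) ⟩
      reduce (mapᵣ τ (reduce (prefix X) midX)) (relabel τ (word X after))
        ≡⟨ reduce-relabel τ _ (word X after) ⟩
      mapᵣ τ (reduce (reduce (prefix X) midX) (word X after))
        ≡⟨ cong (mapᵣ τ) (sym (state-around₂ X split)) ⟩
      mapᵣ τ (state X) ∎
      where
      open ≡-Reasoning
      midX = signsAt i X a ++ signsAt i X b
      midY = signsAt i Y a ++ signsAt i Y b
      prefix-fixed : mapᵣ τ (prefix X) ≡ prefix X
      prefix-fixed = trans (sym (reduce-relabel τ ∅ (word X before)))
                           (cong (reduce ∅) (word-relabel X before-avoids))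

    lowerPos-relabel : ∀ X Y → state Y ≡ mapᵣ τ (state X) → lowerPos O i Y ≡ Maybe.map τ (lowerPos O i X)
    lowerPos-relabel X Y e = begin
      lowerPos O i Y                   ≡⟨ lowerPos-state Y ⟩
      last (proj₁ (state Y))           ≡⟨ cong (last ∘ proj₁) e ⟩
      last (map τ (proj₁ (state X)))   ≡⟨ last-map τ (proj₁ (state X)) ⟩
      Maybe.map τ (last (proj₁ (state X))) ≡⟨ cong (Maybe.map τ) (sym (lowerPos-state X)) ⟩
      Maybe.map τ (lowerPos O i X)     ∎
      where open ≡-Reasoning

    raisePos-relabel : ∀ X Y → state Y ≡ mapᵣ τ (state X) → raisePos O i Y ≡ Maybe.map τ (raisePos O i X)
    raisePos-relabel X Y e = begin
      raisePos O i Y                   ≡⟨ raisePos-state Y ⟩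
      head (proj₂ (state Y))           ≡⟨ cong (head ∘ proj₂) e ⟩
      head (map τ (proj₂ (state X)))   ≡⟨ head-map (proj₂ (state X)) ⟩
      Maybe.map τ (head (proj₂ (state X))) ≡⟨ cong (Maybe.map τ) (sym (raisePos-state X)) ⟩
      Maybe.map τ (raisePos O i X)     ∎
      where open ≡-Reasoning

bind-cong : ∀ {A B : Set} (m : Maybe A) {g h : A → Maybe B} → (∀ x → g x ≡ h x) → (m >>= g) ≡ (m >>= h)
bind-cong nothing  _    = refl
bind-cong (just x) g≗h = g≗h x

module _ {A B C : Set} where

  map-bind : ∀ (f : B → C) (m : Maybe A) (g : A → Maybe B) → Maybe.map f (m >>= g) ≡ (m >>= Maybe.map f ∘ g)
  map-bind f nothing  g = refl
  map-bind f (just x) g = refl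

  bind-map : ∀ (m : Maybe A) (f : A → B) (g : B → Maybe C) → (Maybe.map f m >>= g) ≡ (m >>= g ∘ f)
  bind-map nothing  f g = refl
  bind-map (just x) f g = refl

module PartialMovesCommute
  {X P Q : Set} (posF : X → Maybe P) (Fm : P → X → X) (posG : X → Maybe Q) (Gm : Q → X → X)
  {InF OutF : P → Set} (classifyF : ∀ t → InF t ⊎ OutF t) (σF : P → P) (σF-out : ∀ {t} → OutF t → σF t ≡ t)
  {InG OutG : Q → Set} (classifyG : ∀ k → InG k ⊎ OutG k) (σG : Q → Q) (σG-out : ∀ {k} → OutG k → σG k ≡ k)
  (F-after-G-out : ∀ x k → posG x ≡ just k → OutG k → posF (Gm k x) ≡ posF x)
  (F-after-G-in  : ∀ x k → posG x ≡ just k → InG k → posF (Gm k x) ≡ Maybe.map σF (posF x))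
  (G-after-F-out : ∀ x t → posF x ≡ just t → OutF t → posG (Fm t x) ≡ posG x)
  (G-after-F-in  : ∀ x t → posF x ≡ just t → InF t → posG (Fm t x) ≡ Maybe.map σG (posG x))
  (disjoint : ∀ x t k → OutF t ⊎ OutG k → Gm k (Fm t x) ≡ Fm t (Gm k x))
  (in-block : ∀ x t k → posF x ≡ just t → posG x ≡ just k → InF t → InG k →
              Gm (σG k) (Fm t x) ≡ Fm (σF t) (Gm k x))
  where

  private
    F-after-G : ∀ x k → posG x ≡ just k → posF x ≡ nothing → posF (Gm k x) ≡ nothing
    F-after-G x k eG eF with classifyG k
    ... | inj₁ k-in  = trans (F-after-G-in x k eG k-in) (cong (Maybe.map σF) eF)
    ... | inj₂ k-out = trans (F-after-G-out x k eG k-out) eF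

    G-after-F : ∀ x t → posF x ≡ just t → posG x ≡ nothing → posG (Fm t x) ≡ nothing
    G-after-F x t eF eG with classifyF t
    ... | inj₁ t-in  = trans (G-after-F-in x t eF t-in) (cong (Maybe.map σG) eG)
    ... | inj₂ t-out = trans (G-after-F-out x t eF t-out) eG

    both-defined : ∀ x t k → posF x ≡ just t → posG x ≡ just k →
      Maybe.map (λ k′ → Gm k′ (Fm t x)) (posG (Fm t x)) ≡ Maybe.map (λ t′ → Fm t′ (Gm k x)) (posF (Gm k x))
    both-defined x t k eF eG with classifyF t | classifyG k
    ... | inj₂ t-out | inj₂ k-out
      rewrite G-after-F-out x t eF t-out | F-after-G-out x k eG k-out | eF | eG =
        cong just (disjoint x t k (inj₁ t-out))
    ... | inj₂ t-out | inj₁ k-in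
      rewrite G-after-F-out x t eF t-out | F-after-G-in x k eG k-in | eF | eG | σF-out t-out =
        cong just (disjoint x t k (inj₁ t-out))
    ... | inj₁ t-in | inj₂ k-out
      rewrite G-after-F-in x t eF t-in | F-after-G-out x k eG k-out | eF | eG | σG-out k-out =
        cong just (disjoint x t k (inj₂ k-out))
    ... | inj₁ t-in | inj₁ k-in
      rewrite G-after-F-in x t eF t-in | F-after-G-in x k eG k-in | eF | eG =
        cong just (in-block x t k eF eG t-in k-in)

  commute : ∀ x → (Maybe.map (λ t → Fm t x) (posF x) >>= λ y → Maybe.map (λ k → Gm k y) (posG y))
                ≡ (Maybe.map (λ k → Gm k x) (posG x) >>= λ y → Maybe.map (λ t → Fm t y) (posF y))
  commute x with posF x in eF | posG x in eG
  ... | nothing | nothing = refl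
  ... | nothing | just k  = sym (cong (Maybe.map (λ t → Fm t (Gm k x))) (F-after-G x k eG eF))
  ... | just t  | nothing = cong (Maybe.map (λ k → Gm k (Fm t x))) (G-after-F x t eF eG)
  ... | just t  | just k  = both-defined x t k eF eG

-- As f and e are mutually inverse, ψ is defined either everywhere or nowhere on a component.
module _ {X I W : Set} (f e : I → X → Maybe X) (w : X → W) (ψ : X → Maybe X)
  (f⇒e : ∀ i b b′ → f i b ≡ just b′ → e i b′ ≡ just b)
  (e⇒f : ∀ i b b′ → e i b ≡ just b′ → f i b′ ≡ just b)
  (ψ-f : ∀ i b → (f i b >>= ψ) ≡ (ψ b >>= f i))
  (ψ-e : ∀ i b → (e i b >>= ψ) ≡ (ψ b >>= e i))
  (ψ-injective : ∀ b b′ c → ψ b ≡ just c → ψ b′ ≡ just c → b ≡ b′)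
  (ψ-weight : ∀ b b′ → ψ b ≡ just b′ → w b′ ≡ w b) where

  private
    bind-just : ∀ {A : Set} (m : Maybe X) (g : X → Maybe A) {c} → (m >>= g) ≡ just c → ∃ λ x → m ≡ just x
    bind-just (just x) g _ = x , refl

  zero-on-component : ∀ {b₀ b} → ψ b₀ ≡ nothing → Reach f e b₀ b → ψ b ≡ nothing
  zero-on-component z here = z
  zero-on-component z (viaF {b} i r eq) =
    trans (cong (_>>= ψ) (sym eq)) (trans (ψ-f i b) (cong (_>>= f i) (zero-on-component z r)))
  zero-on-component z (viaE {b} i r eq) =
    trans (cong (_>>= ψ) (sym eq)) (trans (ψ-e i b) (cong (_>>= e i) (zero-on-component z r)))

  defined-on-component : ∀ {b₀ b c} → ψ b₀ ≡ just c → Reach f e b₀ b → ∃ λ c′ → ψ b ≡ just c′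
  defined-on-component d here = _ , d
  defined-on-component d (viaF {b} {b′} i r eq) with defined-on-component d r
  ... | _ , ψb = bind-just (ψ b′) (e i) (trans (sym (ψ-e i b′)) (trans (cong (_>>= ψ) (f⇒e i b b′ eq)) ψb))
  defined-on-component d (viaE {b} {b′} i r eq) with defined-on-component d r
  ... | _ , ψb = bind-just (ψ b′) (f i) (trans (sym (ψ-f i b′)) (trans (cong (_>>= ψ) (e⇒f i b b′ eq)) ψb))

  zeroOrIso : ∀ b₀ → ZeroOrIso f e w ψ b₀
  zeroOrIso b₀ with ψ b₀ in eq
  ... | nothing = inj₁ (λ b r → zero-on-component eq r)
  ... | just c  = inj₂ ( (λ b r → is-just (defined-on-component eq r))
                       , (λ b b′ r r′ ψb≡ψb′ → injective (defined-on-component eq r) ψb≡ψb′)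
                       , (λ b b′ r → ψ-weight b b′)
                       , (λ i b r → ψ-f i b)
                       , (λ i b r → ψ-e i b))
    where
    is-just : ∀ {b} → (∃ λ c′ → ψ b ≡ just c′) → Is-just (ψ b)
    is-just (c′ , ψb) rewrite ψb = just tt
    injective : ∀ {b b′} → (∃ λ c′ → ψ b ≡ just c′) → ψ b ≡ ψ b′ → b ≡ b′
    injective (c′ , ψb) ψb≡ψb′ = ψ-injective _ _ c′ ψb (trans (sym ψb≡ψb′) ψb)

module _ {a b : ℕ} where

  star-injective : ∀ (A A′ : Tensor b a → Maybe (Tensor b a)) → (∀ X Y → A X ≡ just Y → A′ Y ≡ just X) →
    ∀ (x y : Tensor a b) c → star A x ≡ just c → star A y ≡ just c → x ≡ y
  star-injective A A′ inverse x y c ex ey with A (dual x) in Ax | A (dual y) in Ay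
  star-injective A A′ inverse x y c refl ey | just X | just Y = begin
    x                   ≡⟨ sym (transpose-transpose x) ⟩
    dual (dual x)       ≡⟨ cong dual dx≡dy ⟩
    dual (dual y)       ≡⟨ transpose-transpose y ⟩
    y                   ∎
    where
    open ≡-Reasoning
    X≡Y : X ≡ Y
    X≡Y = trans (sym (transpose-transpose X)) (trans (cong dual (just-injective (sym ey))) (transpose-transpose Y))
    dx≡dy : dual x ≡ dual y
    dx≡dy = just-injective (trans (sym (inverse _ _ Ax)) (trans (cong A′ X≡Y) (inverse _ _ Ay)))

  star-weight : ∀ (A : Tensor b a → Maybe (Tensor b a)) → (∀ X Y → A X ≡ just Y → Vec.map ∣_∣ Y ≡ Vec.map ∣_∣ X) →
    ∀ (x y : Tensor a b) → star A x ≡ just y → wt y ≡ wt x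
  star-weight A sizes x y e with A (dual x) in Ax
  star-weight A sizes x y refl | just Y = trans (cong (Vec.map ∣_∣) (transpose-transpose Y)) (sizes _ _ Ax)

  star-commute-dual : ∀ (A : Tensor a b → Maybe (Tensor a b)) (B : Tensor b a → Maybe (Tensor b a)) →
    (∀ X → (A X >>= star B) ≡ (star B X >>= A)) → ∀ D → (B D >>= star A) ≡ (star A D >>= B)
  star-commute-dual A B commute D = begin
    (B D >>= star A)
      ≡⟨ cong (λ D′ → B D′ >>= star A) (sym (transpose-transpose D)) ⟩
    (B (dual X) >>= star A)
      ≡⟨ sym (bind-map (B (dual X)) dual (Maybe.map dual ∘ A)) ⟩
    (Maybe.map dual (B (dual X)) >>= Maybe.map dual ∘ A)
      ≡⟨ sym (map-bind dual (star B X) A) ⟩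
    Maybe.map dual (star B X >>= A)
      ≡⟨ cong (Maybe.map dual) (sym (commute X)) ⟩
    Maybe.map dual (A X >>= star B)
      ≡⟨ map-bind dual (A X) (star B) ⟩
    (A X >>= Maybe.map dual ∘ star B)
      ≡⟨ bind-cong (A X) (λ Y → map-dual-dual (B (dual Y))) ⟩
    (A X >>= B ∘ dual)
      ≡⟨ sym (bind-map (A X) dual B) ⟩
    (star A D >>= B) ∎
    where
    open ≡-Reasoning
    X = dual D
    map-dual-dual : ∀ {p q} (m : Maybe (Tensor p q)) → Maybe.map dual (Maybe.map dual m) ≡ m
    map-dual-dual nothing  = refl
    map-dual-dual (just Y) = cong just (transpose-transpose Y)

-- F(s) is read on the rows of a 0/1 matrix X (factor c_{t+1} = row t) and Ḟ(s) on its columns;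
-- the letters i+1, i+2 of F(s) are the columns k₁, k₂ and the letters j+1, j+2 of Ḟ(s)
-- are the rows r₂, r₁ (named so that r₁ comes first in the reading order of F(s)).
module Bicrystal {n′ ℓ′ : ℕ} (i : Fin n′) (j : Fin ℓ′) where

  Mat : Set
  Mat = Matrix (suc ℓ′) (suc n′)

  module F = SignatureRule (reverse (allFin (suc ℓ′))) i
  module G = SignatureRule (allFin (suc n′)) j

  k₁ k₂ : Fin (suc n′)
  k₁ = F.k₁
  k₂ = F.k₂

  r₁ r₂ : Fin (suc ℓ′)
  r₁ = G.k₂
  r₂ = G.k₁

  r₁≢r₂ : r₁ ≢ r₂
  r₁≢r₂ = G.k₁≢k₂ ∘ sym

  BlockRow : Fin (suc ℓ′) → Set
  BlockRow t = t ≡ r₁ ⊎ t ≡ r₂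

  BlockCol : Fin (suc n′) → Set
  BlockCol k = k ≡ k₁ ⊎ k ≡ k₂

  F-adjacent : AdjacentIn r₁ r₂ (reverse (allFin (suc ℓ′)))
  F-adjacent = adjacentIn-reverse (adjacentIn-allFin j)

  G-adjacent : AdjacentIn k₁ k₂ (allFin (suc n′))
  G-adjacent = adjacentIn-allFin i

  F-lowerPos F-raisePos : Mat → Maybe (Fin (suc ℓ′))
  F-lowerPos = lowerPos (reverse (allFin (suc ℓ′))) i
  F-raisePos = raisePos (reverse (allFin (suc ℓ′))) i

  G-lowerPos G-raisePos : Mat → Maybe (Fin (suc n′))
  G-lowerPos X = lowerPos (allFin (suc n′)) j (transpose X)
  G-raisePos X = raisePos (allFin (suc n′)) j (transpose X)

  G-lower G-raise : Fin (suc n′) → Mat → Mat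
  G-lower k X = transpose (G.lower k (transpose X))
  G-raise k X = transpose (G.raise k (transpose X))

  G-lower-colMove : ∀ k X → ColMove r₁ r₂ k true false X (G-lower k X)
  G-lower-colMove k X = rowMove-transpose (rowMove-swap (G.lower-rowMove k (transpose X)))

  G-raise-colMove : ∀ k X → ColMove r₁ r₂ k false true X (G-raise k X)
  G-raise-colMove k X = rowMove-transpose (rowMove-swap (G.raise-rowMove k (transpose X)))

  G-signsAt : ∀ (X : Mat) u → signsAt j (transpose X) u ≡ signs (entry X r₂ u) (entry X r₁ u) u
  G-signsAt X u = G.signsAt-≡ (transpose X) u (entry-transpose X r₂ u , entry-transpose X r₁ u)

  G-state : Mat → Reduced (Fin (suc n′))
  G-state X = G.state (transpose X)

  σF : Fin (suc ℓ′) → Fin (suc ℓ′)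
  σF = PC.transpose r₁ r₂

  σG : Fin (suc n′) → Fin (suc n′)
  σG = PC.transpose k₁ k₂

  σF-r₁ : σF r₁ ≡ r₂
  σF-r₁ = transposition-first {a = r₁} {r₂}
  σF-r₂ : σF r₂ ≡ r₁
  σF-r₂ = transposition-second {a = r₁} {r₂}
  σG-k₁ : σG k₁ ≡ k₂
  σG-k₁ = transposition-first {a = k₁} {k₂}
  σG-k₂ : σG k₂ ≡ k₁
  σG-k₂ = transposition-second {a = k₁} {k₂}

  F-middle : Mat → List (Bool × Fin (suc ℓ′))
  F-middle X = signsAt i X r₁ ++ signsAt i X r₂

  G-middle : Mat → List (Bool × Fin (suc n′))
  G-middle X = signsAt j (transpose X) k₁ ++ signsAt j (transpose X) k₂

  -- The block entries are written c = (r₁,k₁), d = (r₁,k₂), a = (r₂,k₁), b = (r₂,k₂).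
  F-middle-≡ : ∀ X {c d a b} → entry X r₁ k₁ ≡ c → entry X r₁ k₂ ≡ d → entry X r₂ k₁ ≡ a → entry X r₂ k₂ ≡ b →
    F-middle X ≡ signs c d r₁ ++ signs a b r₂
  F-middle-≡ X e₁₁ e₁₂ e₂₁ e₂₂ = cong₂ _++_ (F.signsAt-≡ X r₁ (e₁₁ , e₁₂)) (F.signsAt-≡ X r₂ (e₂₁ , e₂₂))

  G-middle-≡ : ∀ X {c d a b} → entry X r₁ k₁ ≡ c → entry X r₁ k₂ ≡ d → entry X r₂ k₁ ≡ a → entry X r₂ k₂ ≡ b →
    G-middle X ≡ signs a c k₁ ++ signs b d k₂
  G-middle-≡ X e₁₁ e₁₂ e₂₁ e₂₂ =
    cong₂ _++_ (trans (G-signsAt X k₁) (cong₂ (λ x y → signs x y k₁) e₂₁ e₁₁))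
               (trans (G-signsAt X k₂) (cong₂ (λ x y → signs x y k₂) e₂₂ e₁₂))

  G-Letters : Mat → Fin (suc n′) → Bool → Bool → Set
  G-Letters X k x y = entry X r₂ k ≡ x × entry X r₁ k ≡ y

  private
    G-letters : ∀ X k {x y} → G-Letters X k x y → G.Letters (transpose X) k x y
    G-letters X k (e₂ , e₁) = trans (entry-transpose X r₂ k) e₂ , trans (entry-transpose X r₁ k) e₁

    letters-G : ∀ X k {x y} → G.Letters (transpose X) k x y → G-Letters X k x y
    letters-G X k (e₂ , e₁) = trans (sym (entry-transpose X r₂ k)) e₂ , trans (sym (entry-transpose X r₁ k)) e₁

  G-¬lowerPos-cancelled : ∀ X → G-Letters X k₁ true false → G-Letters X k₂ false true → G-lowerPos X ≢ just k₁
  G-¬lowerPos-cancelled X la lb = G.¬lowerPos-cancelled G-adjacent (transpose X) (G-letters X k₁ la) (G-letters X k₂ lb)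

  G-¬raisePos-cancelled : ∀ X → G-Letters X k₁ true false → G-Letters X k₂ false true → G-raisePos X ≢ just k₂
  G-¬raisePos-cancelled X la lb = G.¬raisePos-cancelled G-adjacent (transpose X) (G-letters X k₁ la) (G-letters X k₂ lb)

  G-¬lowerPos-second-plus : ∀ X → G-Letters X k₁ true false → G-Letters X k₂ true false → G-lowerPos X ≢ just k₂
  G-¬lowerPos-second-plus X la lb =
    G.¬lowerPos-second-plus G-adjacent F.k₁≢k₂ (transpose X) (G-letters X k₁ la) (G-letters X k₂ lb)

  G-¬raisePos-first-minus : ∀ X → G-Letters X k₁ false true → G-Letters X k₂ false true → G-raisePos X ≢ just k₁
  G-¬raisePos-first-minus X la lb =
    G.¬raisePos-first-minus G-adjacent F.k₁≢k₂ (transpose X) (G-letters X k₁ la) (G-letters X k₂ lb)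

  F-lowerPos-entries : ∀ X t → F-lowerPos X ≡ just t → F.Letters X t true false
  F-lowerPos-entries = F.lowerPos-entries onceIn-reverse-allFin

  F-raisePos-entries : ∀ X t → F-raisePos X ≡ just t → F.Letters X t false true
  F-raisePos-entries = F.raisePos-entries onceIn-reverse-allFin

  G-lowerPos-entries : ∀ X k → G-lowerPos X ≡ just k → G-Letters X k true false
  G-lowerPos-entries X k e = letters-G X k (G.lowerPos-entries onceIn-allFin (transpose X) k e)

  G-raisePos-entries : ∀ X k → G-raisePos X ≡ just k → G-Letters X k false true
  G-raisePos-entries X k e = letters-G X k (G.raisePos-entries onceIn-allFin (transpose X) k e)

  F-state-unchanged : ∀ {k y₁ y₂ X Y} → ColMove r₁ r₂ k y₁ y₂ X Y → k ≢ k₁ × k ≢ k₂ → F.state Y ≡ F.state X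
  F-state-unchanged {X = X} {Y} M (k≢k₁ , k≢k₂) = F.state-cong X Y λ u →
    cong₂ (λ x y → signs x y u) (ColMove.other-cols M u k₁ (k≢k₁ ∘ sym))
                                (ColMove.other-cols M u k₂ (k≢k₂ ∘ sym))

  G-state-unchanged : ∀ {t x₁ x₂ X Y} → RowMove k₁ k₂ t x₁ x₂ X Y → t ≢ r₁ × t ≢ r₂ → G-state Y ≡ G-state X
  G-state-unchanged {X = X} {Y} M (t≢r₁ , t≢r₂) = G.state-cong (transpose X) (transpose Y) λ u → begin
    signsAt j (transpose Y) u                   ≡⟨ G-signsAt Y u ⟩
    signs (entry Y r₂ u) (entry Y r₁ u) u
      ≡⟨ cong₂ (λ x y → signs x y u) (rowMove-untouched M (inj₁ (t≢r₂ ∘ sym)))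
                                     (rowMove-untouched M (inj₁ (t≢r₁ ∘ sym))) ⟩
    signs (entry X r₂ u) (entry X r₁ u) u       ≡⟨ sym (G-signsAt X u) ⟩
    signsAt j (transpose X) u                   ∎
    where open ≡-Reasoning

  F-state-relabelled : ∀ {k y₁ y₂ X Y} → ColMove r₁ r₂ k y₁ y₂ X Y → Relabels σF (F-middle X) (F-middle Y) →
    F.state Y ≡ mapᵣ σF (F.state X)
  F-state-relabelled {X = X} {Y} M = F.state-relabel F-adjacent X Y λ u u∉ →
    cong₂ (λ x y → signs x y u) (colMove-untouched M (inj₁ u∉)) (colMove-untouched M (inj₁ u∉))

  G-state-relabelled : ∀ {t x₁ x₂ X Y} → RowMove k₁ k₂ t x₁ x₂ X Y → Relabels σG (G-middle X) (G-middle Y) →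
    G-state Y ≡ mapᵣ σG (G-state X)
  G-state-relabelled {X = X} {Y} M =
    G.state-relabel G-adjacent (transpose X) (transpose Y) λ u (u≢k₁ , u≢k₂) → begin
    signsAt j (transpose Y) u                   ≡⟨ G-signsAt Y u ⟩
    signs (entry Y r₂ u) (entry Y r₁ u) u
      ≡⟨ cong₂ (λ x y → signs x y u) (rowMove-untouched M (inj₂ (u≢k₁ , u≢k₂)))
                                     (rowMove-untouched M (inj₂ (u≢k₁ , u≢k₂))) ⟩
    signs (entry X r₂ u) (entry X r₁ u) u       ≡⟨ sym (G-signsAt X u) ⟩
    signsAt j (transpose X) u                   ∎
    where open ≡-Reasoning

  k₂≢k₁ : k₂ ≢ k₁
  k₂≢k₁ = F.k₁≢k₂ ∘ sym

  r₂≢r₁ : r₂ ≢ r₁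
  r₂≢r₁ = G.k₁≢k₂

  -- A move of Ḟ(s) in the columns k₁, k₂ swaps the roles of the rows r₁, r₂ for F(s).
  F-relabelled-by-G-lower : ∀ X k → G-lowerPos X ≡ just k → BlockCol k →
    F.state (G-lower k X) ≡ mapᵣ σF (F.state X)
  F-relabelled-by-G-lower X _ e (inj₁ refl) with G-lowerPos-entries X k₁ e
  ... | a , c = F-state-relabelled M (subst₂ (Relabels σF)
      (sym (F-middle-≡ X c refl a refl))
      (sym (F-middle-≡ (G-lower k₁ X) (ColMove.at₁ M) (ColMove.other-cols M r₁ k₂ k₂≢k₁)
                                      (ColMove.at₂ M) (ColMove.other-cols M r₂ k₂ k₂≢k₁)))
      (plus-moves-forward σF σF-r₁ σF-r₂ (entry X r₁ k₂) (entry X r₂ k₂) λ (d , b) →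
        G-¬lowerPos-cancelled X (a , c) (b , d) e))
    where M = G-lower-colMove k₁ X
  F-relabelled-by-G-lower X _ e (inj₂ refl) with G-lowerPos-entries X k₂ e
  ... | b , d = F-state-relabelled M (subst₂ (Relabels σF)
      (sym (F-middle-≡ X refl d refl b))
      (sym (F-middle-≡ (G-lower k₂ X) (ColMove.other-cols M r₁ k₁ F.k₁≢k₂) (ColMove.at₁ M)
                                      (ColMove.other-cols M r₂ k₁ F.k₁≢k₂) (ColMove.at₂ M)))
      (minus-moves-forward σF σF-r₁ σF-r₂ (entry X r₁ k₁) (entry X r₂ k₁) λ (c , a) →
        G-¬lowerPos-second-plus X (a , c) (b , d) e))
    where M = G-lower-colMove k₂ X

  F-relabelled-by-G-raise : ∀ X k → G-raisePos X ≡ just k → BlockCol k →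
    F.state (G-raise k X) ≡ mapᵣ σF (F.state X)
  F-relabelled-by-G-raise X _ e (inj₁ refl) with G-raisePos-entries X k₁ e
  ... | a , c = F-state-relabelled M (relabels-sym σF transposition-involutive (subst₂ (Relabels σF)
      (sym (F-middle-≡ (G-raise k₁ X) (ColMove.at₁ M) (ColMove.other-cols M r₁ k₂ k₂≢k₁)
                                      (ColMove.at₂ M) (ColMove.other-cols M r₂ k₂ k₂≢k₁)))
      (sym (F-middle-≡ X c refl a refl))
      (plus-moves-forward σF σF-r₁ σF-r₂ (entry X r₁ k₂) (entry X r₂ k₂) λ (d , b) →
        G-¬raisePos-first-minus X (a , c) (b , d) e)))
    where M = G-raise-colMove k₁ X
  F-relabelled-by-G-raise X _ e (inj₂ refl) with G-raisePos-entries X k₂ e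
  ... | b , d = F-state-relabelled M (relabels-sym σF transposition-involutive (subst₂ (Relabels σF)
      (sym (F-middle-≡ (G-raise k₂ X) (ColMove.other-cols M r₁ k₁ F.k₁≢k₂) (ColMove.at₁ M)
                                      (ColMove.other-cols M r₂ k₁ F.k₁≢k₂) (ColMove.at₂ M)))
      (sym (F-middle-≡ X refl d refl b))
      (minus-moves-forward σF σF-r₁ σF-r₂ (entry X r₁ k₁) (entry X r₂ k₁) λ (c , a) →
        G-¬raisePos-cancelled X (a , c) (b , d) e)))
    where M = G-raise-colMove k₂ X

  -- A move of F(s) in the rows r₁, r₂ swaps the roles of the columns k₁, k₂ for Ḟ(s).
  G-relabelled-by-F-lower : ∀ X t → F-lowerPos X ≡ just t → BlockRow t →
    G-state (F.lower t X) ≡ mapᵣ σG (G-state X)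
  G-relabelled-by-F-lower X _ e (inj₁ refl) with F-lowerPos-entries X r₁ e
  ... | c , d = G-state-relabelled M (relabels-sym σG transposition-involutive (subst₂ (Relabels σG)
      (sym (G-middle-≡ (F.lower r₁ X) (RowMove.at₁ M) (RowMove.at₂ M)
                                      (rowMove-untouched M (inj₁ r₂≢r₁)) (rowMove-untouched M (inj₁ r₂≢r₁))))
      (sym (G-middle-≡ X c d refl refl))
      (minus-moves-forward σG σG-k₁ σG-k₂ (entry X r₂ k₁) (entry X r₂ k₂) λ (a , b) →
        F.¬lowerPos-cancelled F-adjacent X (c , d) (a , b) e)))
    where M = F.lower-rowMove r₁ X
  G-relabelled-by-F-lower X _ e (inj₂ refl) with F-lowerPos-entries X r₂ e
  ... | a , b = G-state-relabelled M (relabels-sym σG transposition-involutive (subst₂ (Relabels σG)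
      (sym (G-middle-≡ (F.lower r₂ X) (rowMove-untouched M (inj₁ r₁≢r₂)) (rowMove-untouched M (inj₁ r₁≢r₂))
                                      (RowMove.at₁ M) (RowMove.at₂ M)))
      (sym (G-middle-≡ X refl refl a b))
      (plus-moves-forward σG σG-k₁ σG-k₂ (entry X r₁ k₁) (entry X r₁ k₂) λ (c , d) →
        F.¬lowerPos-second-plus F-adjacent r₁≢r₂ X (c , d) (a , b) e)))
    where M = F.lower-rowMove r₂ X

  G-relabelled-by-F-raise : ∀ X t → F-raisePos X ≡ just t → BlockRow t →
    G-state (F.raise t X) ≡ mapᵣ σG (G-state X)
  G-relabelled-by-F-raise X _ e (inj₁ refl) with F-raisePos-entries X r₁ e
  ... | c , d = G-state-relabelled M (subst₂ (Relabels σG)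
      (sym (G-middle-≡ X c d refl refl))
      (sym (G-middle-≡ (F.raise r₁ X) (RowMove.at₁ M) (RowMove.at₂ M)
                                      (rowMove-untouched M (inj₁ r₂≢r₁)) (rowMove-untouched M (inj₁ r₂≢r₁))))
      (minus-moves-forward σG σG-k₁ σG-k₂ (entry X r₂ k₁) (entry X r₂ k₂) λ (a , b) →
        F.¬raisePos-first-minus F-adjacent r₁≢r₂ X (c , d) (a , b) e))
    where M = F.raise-rowMove r₁ X
  G-relabelled-by-F-raise X _ e (inj₂ refl) with F-raisePos-entries X r₂ e
  ... | a , b = G-state-relabelled M (subst₂ (Relabels σG)
      (sym (G-middle-≡ X refl refl a b))
      (sym (G-middle-≡ (F.raise r₂ X) (rowMove-untouched M (inj₁ r₁≢r₂)) (rowMove-untouched M (inj₁ r₁≢r₂))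
                                      (RowMove.at₁ M) (RowMove.at₂ M)))
      (plus-moves-forward σG σG-k₁ σG-k₂ (entry X r₁ k₁) (entry X r₁ k₂) λ (c , d) →
        F.¬raisePos-cancelled F-adjacent X (c , d) (a , b) e))
    where M = F.raise-rowMove r₂ X

  OffBlock : Fin (suc ℓ′) → Fin (suc n′) → Set
  OffBlock u k = (u ≢ r₁ × u ≢ r₂) ⊎ (k ≢ k₁ × k ≢ k₂)

  record SameOffBlock (X Y : Mat) : Set where
    constructor sameOffBlock
    field same : ∀ u k → OffBlock u k → entry Y u k ≡ entry X u k

  rowMove-in-block : ∀ {t x₁ x₂} {X Y : Mat} → RowMove k₁ k₂ t x₁ x₂ X Y → BlockRow t → SameOffBlock X Y
  rowMove-in-block M t∈ = sameOffBlock λ where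
    u k (inj₁ (u≢r₁ , u≢r₂)) → rowMove-untouched M (inj₁ λ { refl → [ u≢r₁ , u≢r₂ ]′ t∈ })
    u k (inj₂ k∉)            → rowMove-untouched M (inj₂ k∉)

  colMove-in-block : ∀ {k y₁ y₂} {X Y : Mat} → ColMove r₁ r₂ k y₁ y₂ X Y → BlockCol k → SameOffBlock X Y
  colMove-in-block M k∈ = sameOffBlock λ where
    u k′ (inj₁ u∉)              → colMove-untouched M (inj₁ u∉)
    u k′ (inj₂ (k′≢k₁ , k′≢k₂)) → colMove-untouched M (inj₂ λ { refl → [ k′≢k₁ , k′≢k₂ ]′ k∈ })

  sameOffBlock-trans : ∀ {X Y Z : Mat} → SameOffBlock X Y → SameOffBlock Y Z → SameOffBlock X Z
  sameOffBlock-trans (sameOffBlock XY) (sameOffBlock YZ) = sameOffBlock λ u k off → trans (YZ u k off) (XY u k off)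

  block-ext : ∀ {X Y Z : Mat} → SameOffBlock X Y → SameOffBlock X Z →
    entry Y r₁ k₁ ≡ entry Z r₁ k₁ → entry Y r₁ k₂ ≡ entry Z r₁ k₂ →
    entry Y r₂ k₁ ≡ entry Z r₂ k₁ → entry Y r₂ k₂ ≡ entry Z r₂ k₂ → Y ≡ Z
  block-ext {Y = Y} {Z} (sameOffBlock XY) (sameOffBlock XZ) e₁₁ e₁₂ e₂₁ e₂₂ = entry-ext cell
    where
    off : ∀ {u k} → OffBlock u k → entry Y u k ≡ entry Z u k
    off h = trans (XY _ _ h) (sym (XZ _ _ h))
    cell : ∀ u k → entry Y u k ≡ entry Z u k
    cell u k with u ≟ r₁ | u ≟ r₂ | k ≟ k₁ | k ≟ k₂
    ... | yes refl | _        | yes refl | _        = e₁₁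
    ... | yes refl | _        | no _     | yes refl = e₁₂
    ... | no _     | yes refl | yes refl | _        = e₂₁
    ... | no _     | yes refl | no _     | yes refl = e₂₂
    ... | yes refl | _        | no k≢k₁  | no k≢k₂  = off (inj₂ (k≢k₁ , k≢k₂))
    ... | no _     | yes refl | no k≢k₁  | no k≢k₂  = off (inj₂ (k≢k₁ , k≢k₂))
    ... | no u≢r₁  | no u≢r₂  | _        | _        = off (inj₁ (u≢r₁ , u≢r₂))

  private
    infixr 5 _∙_
    _∙_ : ∀ {A : Set} {x y z : A} → x ≡ y → y ≡ z → x ≡ z
    _∙_ = trans

    true≢false : true ≢ false
    true≢false ()

    off-row : ∀ {t x₁ x₂} {X Y : Mat} → RowMove k₁ k₂ t x₁ x₂ X Y → ∀ {u k} → u ≢ t → entry Y u k ≡ entry X u k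
    off-row M u≢t = rowMove-untouched M (inj₁ u≢t)

    off-col : ∀ {k y₁ y₂} {X Y : Mat} → ColMove r₁ r₂ k y₁ y₂ X Y → ∀ {u k′} → k′ ≢ k → entry Y u k′ ≡ entry X u k′
    off-col M k′≢k = colMove-untouched M (inj₂ k′≢k)

    F-then-G : ∀ {t x₁ x₂ k y₁ y₂} {X Y Z : Mat} → RowMove k₁ k₂ t x₁ x₂ X Y → BlockRow t →
      ColMove r₁ r₂ k y₁ y₂ Y Z → BlockCol k → SameOffBlock X Z
    F-then-G R t∈ C k∈ = sameOffBlock-trans (rowMove-in-block R t∈) (colMove-in-block C k∈)

    G-then-F : ∀ {t x₁ x₂ k y₁ y₂} {X Y Z : Mat} → ColMove r₁ r₂ k y₁ y₂ X Y → BlockCol k →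
      RowMove k₁ k₂ t x₁ x₂ Y Z → BlockRow t → SameOffBlock X Z
    G-then-F C k∈ R t∈ = sameOffBlock-trans (colMove-in-block C k∈) (rowMove-in-block R t∈)

  -- When both moves happen in the block, each one moves the other's position to the
  -- other row (resp. column) of the block; the four entries of the block are then compared.
  block-lower-lower : ∀ X t k → F-lowerPos X ≡ just t → G-lowerPos X ≡ just k → BlockRow t → BlockCol k →
    G-lower (σG k) (F.lower t X) ≡ F.lower (σF t) (G-lower k X)
  block-lower-lower X t k ef eg (inj₁ refl) (inj₁ refl) =
    ⊥-elim (true≢false (sym (proj₁ (F-lowerPos-entries X r₁ ef)) ∙ proj₂ (G-lowerPos-entries X k₁ eg)))
  block-lower-lower X t k ef eg (inj₁ refl) (inj₂ refl) =
    subst₂ (λ a b → G-lower a (F.lower r₁ X) ≡ F.lower b (G-lower k₂ X)) (sym σG-k₂) (sym σF-r₁)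
      (block-ext (F-then-G R (inj₁ refl) C (inj₁ refl)) (G-then-F C′ (inj₂ refl) R′ (inj₂ refl))
        (ColMove.at₁ C ∙ sym (off-row R′ r₁≢r₂ ∙ off-col C′ F.k₁≢k₂ ∙ ec))
        ((off-col C k₂≢k₁ ∙ RowMove.at₂ R) ∙ sym (off-row R′ r₁≢r₂ ∙ ColMove.at₁ C′))
        (ColMove.at₂ C ∙ sym (RowMove.at₁ R′))
        ((off-col C k₂≢k₁ ∙ off-row R r₂≢r₁ ∙ eb) ∙ sym (RowMove.at₂ R′)))
    where
    ec = proj₁ (F-lowerPos-entries X r₁ ef)
    eb = proj₁ (G-lowerPos-entries X k₂ eg)
    R = F.lower-rowMove r₁ X
    C = G-lower-colMove k₁ (F.lower r₁ X)
    C′ = G-lower-colMove k₂ X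
    R′ = F.lower-rowMove r₂ (G-lower k₂ X)
  block-lower-lower X t k ef eg (inj₂ refl) (inj₁ refl) =
    subst₂ (λ a b → G-lower a (F.lower r₂ X) ≡ F.lower b (G-lower k₁ X)) (sym σG-k₁) (sym σF-r₂)
      (block-ext (F-then-G R (inj₂ refl) C (inj₂ refl)) (G-then-F C′ (inj₁ refl) R′ (inj₁ refl))
        ((off-col C F.k₁≢k₂ ∙ off-row R r₁≢r₂ ∙ ec) ∙ sym (RowMove.at₁ R′))
        (ColMove.at₁ C ∙ sym (RowMove.at₂ R′))
        ((off-col C F.k₁≢k₂ ∙ RowMove.at₁ R) ∙ sym (off-row R′ r₂≢r₁ ∙ ColMove.at₂ C′))
        (ColMove.at₂ C ∙ sym (off-row R′ r₂≢r₁ ∙ off-col C′ k₂≢k₁ ∙ eb)))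
    where
    eb = proj₂ (F-lowerPos-entries X r₂ ef)
    ec = proj₂ (G-lowerPos-entries X k₁ eg)
    R = F.lower-rowMove r₂ X
    C = G-lower-colMove k₂ (F.lower r₂ X)
    C′ = G-lower-colMove k₁ X
    R′ = F.lower-rowMove r₁ (G-lower k₁ X)
  block-lower-lower X t k ef eg (inj₂ refl) (inj₂ refl) =
    ⊥-elim (true≢false (sym (proj₁ (G-lowerPos-entries X k₂ eg)) ∙ proj₂ (F-lowerPos-entries X r₂ ef)))

  block-raise-lower : ∀ X t k → F-raisePos X ≡ just t → G-lowerPos X ≡ just k → BlockRow t → BlockCol k →
    G-lower (σG k) (F.raise t X) ≡ F.raise (σF t) (G-lower k X)
  block-raise-lower X t k ef eg (inj₁ refl) (inj₁ refl) =
    subst₂ (λ a b → G-lower a (F.raise r₁ X) ≡ F.raise b (G-lower k₁ X)) (sym σG-k₁) (sym σF-r₁)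
      (block-ext (F-then-G R (inj₁ refl) C (inj₂ refl)) (G-then-F C′ (inj₁ refl) R′ (inj₂ refl))
        ((off-col C F.k₁≢k₂ ∙ RowMove.at₁ R) ∙ sym (off-row R′ r₁≢r₂ ∙ ColMove.at₁ C′))
        (ColMove.at₁ C ∙ sym (off-row R′ r₁≢r₂ ∙ off-col C′ k₂≢k₁ ∙ ed))
        ((off-col C F.k₁≢k₂ ∙ off-row R r₂≢r₁ ∙ ea) ∙ sym (RowMove.at₁ R′))
        (ColMove.at₂ C ∙ sym (RowMove.at₂ R′)))
    where
    ed = proj₂ (F-raisePos-entries X r₁ ef)
    ea = proj₁ (G-lowerPos-entries X k₁ eg)
    R = F.raise-rowMove r₁ X
    C = G-lower-colMove k₂ (F.raise r₁ X)
    C′ = G-lower-colMove k₁ X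
    R′ = F.raise-rowMove r₂ (G-lower k₁ X)
  block-raise-lower X t k ef eg (inj₁ refl) (inj₂ refl) =
    ⊥-elim (true≢false (sym (proj₂ (F-raisePos-entries X r₁ ef)) ∙ proj₂ (G-lowerPos-entries X k₂ eg)))
  block-raise-lower X t k ef eg (inj₂ refl) (inj₁ refl) =
    ⊥-elim (true≢false (sym (proj₁ (G-lowerPos-entries X k₁ eg)) ∙ proj₁ (F-raisePos-entries X r₂ ef)))
  block-raise-lower X t k ef eg (inj₂ refl) (inj₂ refl) =
    subst₂ (λ a b → G-lower a (F.raise r₂ X) ≡ F.raise b (G-lower k₂ X)) (sym σG-k₂) (sym σF-r₂)
      (block-ext (F-then-G R (inj₂ refl) C (inj₁ refl)) (G-then-F C′ (inj₂ refl) R′ (inj₁ refl))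
        (ColMove.at₁ C ∙ sym (RowMove.at₁ R′))
        ((off-col C k₂≢k₁ ∙ off-row R r₁≢r₂ ∙ ed) ∙ sym (RowMove.at₂ R′))
        (ColMove.at₂ C ∙ sym (off-row R′ r₂≢r₁ ∙ off-col C′ F.k₁≢k₂ ∙ ea))
        ((off-col C k₂≢k₁ ∙ RowMove.at₂ R) ∙ sym (off-row R′ r₂≢r₁ ∙ ColMove.at₂ C′)))
    where
    ea = proj₁ (F-raisePos-entries X r₂ ef)
    ed = proj₂ (G-lowerPos-entries X k₂ eg)
    R = F.raise-rowMove r₂ X
    C = G-lower-colMove k₁ (F.raise r₂ X)
    C′ = G-lower-colMove k₂ X
    R′ = F.raise-rowMove r₁ (G-lower k₂ X)

  block-lower-raise : ∀ X t k → F-lowerPos X ≡ just t → G-raisePos X ≡ just k → BlockRow t → BlockCol k →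
    G-raise (σG k) (F.lower t X) ≡ F.lower (σF t) (G-raise k X)
  block-lower-raise X t k ef eg (inj₁ refl) (inj₁ refl) =
    subst₂ (λ a b → G-raise a (F.lower r₁ X) ≡ F.lower b (G-raise k₁ X)) (sym σG-k₁) (sym σF-r₁)
      (block-ext (F-then-G R (inj₁ refl) C (inj₂ refl)) (G-then-F C′ (inj₁ refl) R′ (inj₂ refl))
        ((off-col C F.k₁≢k₂ ∙ RowMove.at₁ R) ∙ sym (off-row R′ r₁≢r₂ ∙ ColMove.at₁ C′))
        (ColMove.at₁ C ∙ sym (off-row R′ r₁≢r₂ ∙ off-col C′ k₂≢k₁ ∙ ed))
        ((off-col C F.k₁≢k₂ ∙ off-row R r₂≢r₁ ∙ ea) ∙ sym (RowMove.at₁ R′))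
        (ColMove.at₂ C ∙ sym (RowMove.at₂ R′)))
    where
    ed = proj₂ (F-lowerPos-entries X r₁ ef)
    ea = proj₁ (G-raisePos-entries X k₁ eg)
    R = F.lower-rowMove r₁ X
    C = G-raise-colMove k₂ (F.lower r₁ X)
    C′ = G-raise-colMove k₁ X
    R′ = F.lower-rowMove r₂ (G-raise k₁ X)
  block-lower-raise X t k ef eg (inj₁ refl) (inj₂ refl) =
    ⊥-elim (true≢false (sym (proj₂ (G-raisePos-entries X k₂ eg)) ∙ proj₂ (F-lowerPos-entries X r₁ ef)))
  block-lower-raise X t k ef eg (inj₂ refl) (inj₁ refl) =
    ⊥-elim (true≢false (sym (proj₁ (F-lowerPos-entries X r₂ ef)) ∙ proj₁ (G-raisePos-entries X k₁ eg)))
  block-lower-raise X t k ef eg (inj₂ refl) (inj₂ refl) =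
    subst₂ (λ a b → G-raise a (F.lower r₂ X) ≡ F.lower b (G-raise k₂ X)) (sym σG-k₂) (sym σF-r₂)
      (block-ext (F-then-G R (inj₂ refl) C (inj₁ refl)) (G-then-F C′ (inj₂ refl) R′ (inj₁ refl))
        (ColMove.at₁ C ∙ sym (RowMove.at₁ R′))
        ((off-col C k₂≢k₁ ∙ off-row R r₁≢r₂ ∙ ed) ∙ sym (RowMove.at₂ R′))
        (ColMove.at₂ C ∙ sym (off-row R′ r₂≢r₁ ∙ off-col C′ F.k₁≢k₂ ∙ ea))
        ((off-col C k₂≢k₁ ∙ RowMove.at₂ R) ∙ sym (off-row R′ r₂≢r₁ ∙ ColMove.at₂ C′)))
    where
    ea = proj₁ (F-lowerPos-entries X r₂ ef)
    ed = proj₂ (G-raisePos-entries X k₂ eg)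
    R = F.lower-rowMove r₂ X
    C = G-raise-colMove k₁ (F.lower r₂ X)
    C′ = G-raise-colMove k₂ X
    R′ = F.lower-rowMove r₁ (G-raise k₂ X)

  classify-row : ∀ t → BlockRow t ⊎ (t ≢ r₁ × t ≢ r₂)
  classify-row t with t ≟ r₁ | t ≟ r₂
  ... | yes t≡r₁ | _        = inj₁ (inj₁ t≡r₁)
  ... | no _     | yes t≡r₂ = inj₁ (inj₂ t≡r₂)
  ... | no t≢r₁  | no t≢r₂  = inj₂ (t≢r₁ , t≢r₂)

  classify-col : ∀ k → BlockCol k ⊎ (k ≢ k₁ × k ≢ k₂)
  classify-col k with k ≟ k₁ | k ≟ k₂
  ... | yes k≡k₁ | _        = inj₁ (inj₁ k≡k₁)
  ... | no _     | yes k≡k₂ = inj₁ (inj₂ k≡k₂)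
  ... | no k≢k₁  | no k≢k₂  = inj₂ (k≢k₁ , k≢k₂)

  module LowerLower = PartialMovesCommute F-lowerPos F.lower G-lowerPos G-lower
    classify-row σF transposition-fixes classify-col σG transposition-fixes
    (λ X k _ out → F.lowerPos-via-state X (G-lower k X) (F-state-unchanged (G-lower-colMove k X) out))
    (λ X k e k∈ → F.lowerPos-relabel F-adjacent X (G-lower k X) (F-relabelled-by-G-lower X k e k∈))
    (λ X t _ out → G.lowerPos-via-state (transpose X) (transpose (F.lower t X))
                     (G-state-unchanged (F.lower-rowMove t X) out))
    (λ X t e t∈ → G.lowerPos-relabel G-adjacent (transpose X) (transpose (F.lower t X))
                    (G-relabelled-by-F-lower X t e t∈))
    (λ X t k out → row-col-moves-commute (F.lower t) (G-lower k) (F.lower-rowMove t) (G-lower-colMove k) out X)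
    block-lower-lower

  module RaiseLower = PartialMovesCommute F-raisePos F.raise G-lowerPos G-lower
    classify-row σF transposition-fixes classify-col σG transposition-fixes
    (λ X k _ out → F.raisePos-via-state X (G-lower k X) (F-state-unchanged (G-lower-colMove k X) out))
    (λ X k e k∈ → F.raisePos-relabel F-adjacent X (G-lower k X) (F-relabelled-by-G-lower X k e k∈))
    (λ X t _ out → G.lowerPos-via-state (transpose X) (transpose (F.raise t X))
                     (G-state-unchanged (F.raise-rowMove t X) out))
    (λ X t e t∈ → G.lowerPos-relabel G-adjacent (transpose X) (transpose (F.raise t X))
                    (G-relabelled-by-F-raise X t e t∈))
    (λ X t k out → row-col-moves-commute (F.raise t) (G-lower k) (F.raise-rowMove t) (G-lower-colMove k) out X)
    block-raise-lower

  module LowerRaise = PartialMovesCommute F-lowerPos F.lower G-raisePos G-raise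
    classify-row σF transposition-fixes classify-col σG transposition-fixes
    (λ X k _ out → F.lowerPos-via-state X (G-raise k X) (F-state-unchanged (G-raise-colMove k X) out))
    (λ X k e k∈ → F.lowerPos-relabel F-adjacent X (G-raise k X) (F-relabelled-by-G-raise X k e k∈))
    (λ X t _ out → G.raisePos-via-state (transpose X) (transpose (F.lower t X))
                     (G-state-unchanged (F.lower-rowMove t X) out))
    (λ X t e t∈ → G.raisePos-relabel G-adjacent (transpose X) (transpose (F.lower t X))
                    (G-relabelled-by-F-lower X t e t∈))
    (λ X t k out → row-col-moves-commute (F.lower t) (G-raise k) (F.lower-rowMove t) (G-raise-colMove k) out X)
    block-lower-raise

  star-fḞ : ∀ X → star (fḞ j) X ≡ Maybe.map (λ k → G-lower k X) (G-lowerPos X)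
  star-fḞ X = sym (map-∘ (G-lowerPos X))

  star-eḞ : ∀ X → star (eḞ j) X ≡ Maybe.map (λ k → G-raise k X) (G-raisePos X)
  star-eḞ X = sym (map-∘ (G-raisePos X))

  fF-star-fḞ : ∀ X → (fF i X >>= star (fḞ j)) ≡ (star (fḞ j) X >>= fF i)
  fF-star-fḞ X = begin
    (fF i X >>= star (fḞ j))                                         ≡⟨ bind-cong (fF i X) star-fḞ ⟩
    (fF i X >>= λ Y → Maybe.map (λ k → G-lower k Y) (G-lowerPos Y)) ≡⟨ LowerLower.commute X ⟩
    (Maybe.map (λ k → G-lower k X) (G-lowerPos X) >>= fF i)           ≡⟨ cong (_>>= fF i) (sym (star-fḞ X)) ⟩
    (star (fḞ j) X >>= fF i)                                         ∎
    where open ≡-Reasoning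

  eF-star-fḞ : ∀ X → (eF i X >>= star (fḞ j)) ≡ (star (fḞ j) X >>= eF i)
  eF-star-fḞ X = begin
    (eF i X >>= star (fḞ j))                                         ≡⟨ bind-cong (eF i X) star-fḞ ⟩
    (eF i X >>= λ Y → Maybe.map (λ k → G-lower k Y) (G-lowerPos Y)) ≡⟨ RaiseLower.commute X ⟩
    (Maybe.map (λ k → G-lower k X) (G-lowerPos X) >>= eF i)           ≡⟨ cong (_>>= eF i) (sym (star-fḞ X)) ⟩
    (star (fḞ j) X >>= eF i)                                         ∎
    where open ≡-Reasoning

  fF-star-eḞ : ∀ X → (fF i X >>= star (eḞ j)) ≡ (star (eḞ j) X >>= fF i)
  fF-star-eḞ X = begin
    (fF i X >>= star (eḞ j))                                         ≡⟨ bind-cong (fF i X) star-eḞ ⟩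
    (fF i X >>= λ Y → Maybe.map (λ k → G-raise k Y) (G-raisePos Y)) ≡⟨ LowerRaise.commute X ⟩
    (Maybe.map (λ k → G-raise k X) (G-raisePos X) >>= fF i)           ≡⟨ cong (_>>= fF i) (sym (star-eḞ X)) ⟩
    (star (eḞ j) X >>= fF i)                                         ∎
    where open ≡-Reasoning

module _ {n′ ℓ′ : ℕ} where

  private
    module F (i : Fin n′) = SignatureRule (reverse (allFin (suc ℓ′))) i
    module G (j : Fin ℓ′) = SignatureRule (allFin (suc n′)) j

  fF⇒eF : ∀ i (X Y : Tensor (suc n′) (suc ℓ′)) → fF i X ≡ just Y → eF i Y ≡ just X
  fF⇒eF i = F.fOp⇒eOp i onceIn-reverse-allFin

  eF⇒fF : ∀ i (X Y : Tensor (suc n′) (suc ℓ′)) → eF i X ≡ just Y → fF i Y ≡ just X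
  eF⇒fF i = F.eOp⇒fOp i onceIn-reverse-allFin

  fF-rowSizes : ∀ i (X Y : Tensor (suc n′) (suc ℓ′)) → fF i X ≡ just Y → Vec.map ∣_∣ Y ≡ Vec.map ∣_∣ X
  fF-rowSizes i = F.fOp-rowSizes i onceIn-reverse-allFin

  fḞ⇒eḞ : ∀ j (X Y : Tensor (suc ℓ′) (suc n′)) → fḞ j X ≡ just Y → eḞ j Y ≡ just X
  fḞ⇒eḞ j = G.fOp⇒eOp j onceIn-allFin

  eḞ⇒fḞ : ∀ j (X Y : Tensor (suc ℓ′) (suc n′)) → eḞ j X ≡ just Y → fḞ j Y ≡ just X
  eḞ⇒fḞ j = G.eOp⇒fOp j onceIn-allFin

  fḞ-rowSizes : ∀ j (X Y : Tensor (suc ℓ′) (suc n′)) → fḞ j X ≡ just Y → Vec.map ∣_∣ Y ≡ Vec.map ∣_∣ X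
  fḞ-rowSizes j = G.fOp-rowSizes j onceIn-allFin

theorem2p21 : (n' ℓ' s : ℕ) → 1 ≤ n' → 1 ≤ ℓ' →
    ((j : Fin ℓ') (b₀ : Tensor (suc n') (suc ℓ')) → size b₀ ≡ s →
      ZeroOrIso (fF {n'} {suc ℓ'}) (eF {n'} {suc ℓ'}) wt (star (fḞ {ℓ'} {suc n'} j)) b₀)
    × ((i : Fin n') (d₀ : Tensor (suc ℓ') (suc n')) → size d₀ ≡ s →
      ZeroOrIso (fḞ {ℓ'} {suc n'}) (eḞ {ℓ'} {suc n'}) wt (star (fF {n'} {suc ℓ'} i)) d₀)
theorem2p21 _ _ _ _ _ =
    (λ j b₀ _ → zeroOrIso fF eF wt (star (fḞ j)) fF⇒eF eF⇒fF
       (λ i → Bicrystal.fF-star-fḞ i j) (λ i → Bicrystal.eF-star-fḞ i j)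
       (star-injective (fḞ j) (eḞ j) (fḞ⇒eḞ j)) (star-weight (fḞ j) (fḞ-rowSizes j)) b₀)
  , (λ i d₀ _ → zeroOrIso fḞ eḞ wt (star (fF i)) fḞ⇒eḞ eḞ⇒fḞ
       (λ j → star-commute-dual (fF i) (fḞ j) (Bicrystal.fF-star-fḞ i j))
       (λ j → star-commute-dual (fF i) (eḞ j) (Bicrystal.fF-star-eḞ i j))
       (star-injective (fF i) (eF i) (fF⇒eF i)) (star-weight (fF i) (fF-rowSizes i)) d₀)
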